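{- Let $\mathbb{G}=(V,E)$ be a ribbon graph. Then a skew class $\omega_e=\{\dot{e},\bar{e},\hat{e}\}$ of $Z(\mathbb{G})$ is singular if and only if $e$ is either a bridge or a trivial loop in $\mathbb{G}$. Furthermore, if $e$ is a bridge then $\bar{e}$ is a singular element, if $e$ is a trivial orientable loop then $\dot{e}$ is a singular element, and if $e$ is a trivial nonorientable loop then $\hat{e}$ is a singular element.
   Context: A ribbon graph $\mathbb G=(V,E)$ is a surface with boundary given as a union of discs, vertices and edges, meeting in disjoint line segments each on the boundary of one vertex and one edge, each edge containing exactly two such segments. $b(\cdot)$ counts boundary components, $k(\cdot)$ connected components; $\mathbb G\setminus Y$ deletes edges in $Y$; $\mathbb G^{\tau(Z)}$ (partial Petrial) reattaches one end of each $e\in Z$ with a half-twist. $\mathcal Q(\mathbb G)$ is the set of ordered partitions $(X,Y,Z)$ of $E$ into three possibly empty blocks with $b(\mathbb G^{\tau(Z)}\setminus Y)=k(\mathbb G)$. $Z(\mathbb G)$ is the $3$-matroid (multimatroid with skew classes $\omega_e=\{\dot e,\bar e,\hat e\}$, $e\in E$, on $U=\{\dot e,\bar e,\hat e:e\in E\}$) whose bases are the transversals $\{\dot e:e\in X\}\cup\{\bar e:e\in Y\}\cup\{\hat e:e\in Z\}$ for $(X,Y,Z)\in\mathcal Q(\mathbb G)$. An element $u$ of a multimatroid with rank function $r$ is singular if $r(\{u\})=0$ (equivalently, for a non-degenerate multimatroid, $u$ lies in no basis); a skew class is singular if it contains a singular element. An edge $e$ is a bridge if $k(\mathbb G\setminus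 e)>k(\mathbb G)$; a loop is an edge incident to one vertex; it is orientable if it together with its vertex forms an annulus, nonorientable if a Möbius band. A loop $e$ is interlaced with a cycle $C$ if, travelling around the boundary of its vertex, edges are seen in cyclic order $e\,c_1\,e\,c_2$ with $c_1,c_2$ edges of $C$ (equal if $C$ is a loop); a loop is trivial if it is interlaced with no cycle. -}

module Defs where

-- Ribbon graphs encoded as signed rotation systems.

open import Data.Nat using (ℕ; zero; suc; _<_; _>_)
open import Data.Nat.DivMod using (_mod_)
open import Data.Bool using (Bool; true; false; not; if_then_else_; _xor_)
open import Data.Fin using (Fin; toℕ; _≟_)
open import Data.List using (List; []; _∷_; length; lookup)
open import Data.Product using (Σ; ∃; _×_; _,_; proj₁; proj₂)
open import Data.Sum using (_⊎_)
open import Relation.Nullary using (¬_; does)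
open import Relation.Binary.PropositionalEquality using (_≡_; _≢_)
open import Relation.Binary.Construct.Closure.ReflexiveTransitive using (Star)

Conn : {A : Set} → (A → A → Set) → A → A → Set
Conn R = Star (λ a b → R a b ⊎ R b a)

HasClasses : (A : Set) → (A → A → Set) → ℕ → Set
HasClasses A R k =
  Σ (Fin k → A) λ r →
    (∀ i j → Conn R (r i) (r j) → i ≡ j) ×
    (∀ a → ∃ λ i → Conn R a (r i))

-- Pre-ribbon graphs: vertices Fin nV, edges Fin nE, each edge has two
-- ends (false/true); each vertex carries the cyclic order (rotation) of
-- the edge-ends attached to it; tw e = true iff edge e is twisted.

HalfEdge : ℕ → Set
HalfEdge nE = Fin nE × Bool

record PreRibbon : Set where
  field
    nV  : ℕ
    nE  : ℕ
    rot : Fin nV → List (HalfEdge nE)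
    tw  : Fin nE → Bool
open PreRibbon public

next : ∀ {n} → Fin n → Fin n
next {suc n} i = suc (toℕ i) mod suc n

-- corners ("flags"): a position in the rotation at v plus a side
-- (false = before, true = after in the rotation direction)
Flag : PreRibbon → Set
Flag G = Σ (Fin (nV G)) λ v → Fin (length (rot G v)) × Bool

data BArc (G : PreRibbon) : Flag G → Flag G → Set where
  vertexArc : ∀ v i → BArc G (v , i , true) (v , next i , false)
  edgeArc   : ∀ v i v' i' e s →
              lookup (rot G v) i ≡ (e , false) →
              lookup (rot G v') i' ≡ (e , true) →
              BArc G (v , i , s) (v' , i' , (if tw G e then s else not s))

-- vertices with no incident edge-end: each is a disc with one boundary
IsolatedV : PreRibbon → Set
IsolatedV G = Σ (Fin (nV G)) λ v → rot G v ≡ []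

BPoint : PreRibbon → Set
BPoint G = Flag G ⊎ IsolatedV G

data BRel (G : PreRibbon) : BPoint G → BPoint G → Set where
  arc : ∀ {x y} → BArc G x y → BRel G (Data.Sum.inj₁ x) (Data.Sum.inj₁ y)

BoundaryCount : PreRibbon → ℕ → Set
BoundaryCount G n = HasClasses (BPoint G) (BRel G) n

Adj : (G : PreRibbon) → Fin (nV G) → Fin (nV G) → Set
Adj G v w = Σ (Fin (nE G)) λ e →
  (∃ λ i → lookup (rot G v) i ≡ (e , false)) ×
  (∃ λ j → lookup (rot G w) j ≡ (e , true))

ComponentCount : PreRibbon → ℕ → Set
ComponentCount G n = HasClasses (Fin (nV G)) (Adj G) n

filterB : {A : Set} → (A → Bool) → List A → List A
filterB p [] = []
filterB p (x ∷ xs) = if p x then x ∷ filterB p xs else filterB p xs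

deleteEdges : (G : PreRibbon) → (Fin (nE G) → Bool) → PreRibbon
deleteEdges G Y = record
  { nV = nV G ; nE = nE G
  ; rot = λ v → filterB (λ h → not (Y (proj₁ h))) (rot G v)
  ; tw = tw G }

partialPetrial : (G : PreRibbon) → (Fin (nE G) → Bool) → PreRibbon
partialPetrial G Z = record
  { nV = nV G ; nE = nE G ; rot = rot G
  ; tw = λ e → tw G e xor Z e }

record RibbonGraph : Set where
  field
    pre      : PreRibbon
    occurs   : ∀ (h : HalfEdge (nE pre)) →
               Σ (Fin (nV pre)) λ v → ∃ λ i → lookup (rot pre v) i ≡ h
    occUniq  : ∀ v w (i : Fin (length (rot pre v))) (j : Fin (length (rot pre w))) →
               lookup (rot pre v) i ≡ lookup (rot pre w) j →
               (v ≡ w) × (toℕ i ≡ toℕ j)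
open RibbonGraph public

Edge : RibbonGraph → Set
Edge G = Fin (nE (pre G))

Vertex : RibbonGraph → Set
Vertex G = Fin (nV (pre G))

data Lbl : Set where
  dot bar hat : Lbl

isBar : Lbl → Bool
isBar bar = true
isBar _   = false

isHat : Lbl → Bool
isHat hat = true
isHat _   = false

-- an ordered partition (X,Y,Z) of E: X = dot-labelled, Y = bar, Z = hat
Partition : RibbonGraph → Set
Partition G = Edge G → Lbl

InQ : (G : RibbonGraph) → Partition G → Set
InQ G p = ∃ λ n →
  BoundaryCount (deleteEdges (partialPetrial (pre G) (λ e → isHat (p e)))
                             (λ e → isBar (p e))) n
  × ComponentCount (pre G) n

-- element (e , l) of U lies in the basis given by p iff p e ≡ l.
-- Singular element: rank of {(e,l)} is 0, i.e. it lies in no basis.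
Singular : (G : RibbonGraph) → Edge G → Lbl → Set
Singular G e l = ¬ (Σ (Partition G) λ p → InQ G p × p e ≡ l)

SingularClass : (G : RibbonGraph) → Edge G → Set
SingularClass G e = Σ Lbl λ l → Singular G e l

Incident : (G : RibbonGraph) → Edge G → Bool → Vertex G → Set
Incident G e b v = ∃ λ i → lookup (rot (pre G) v) i ≡ (e , b)

Joins : (G : RibbonGraph) → Edge G → Vertex G → Vertex G → Set
Joins G e v w = (Incident G e false v × Incident G e true w)
              ⊎ (Incident G e false w × Incident G e true v)

IsBridge : (G : RibbonGraph) → Edge G → Set
IsBridge G e = ∃ λ a → ∃ λ b →
  ComponentCount (pre G) a ×
  ComponentCount (deleteEdges (pre G) (λ f → does (f ≟ e))) b × a < b

IsLoop : (G : RibbonGraph) → Edge G → Set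
IsLoop G e = ∃ λ v → Incident G e false v × Incident G e true v

-- orientable loop (annulus) iff untwisted; nonorientable (Möbius) iff twisted
IsOrientableLoop : (G : RibbonGraph) → Edge G → Set
IsOrientableLoop G e = IsLoop G e × tw (pre G) e ≡ false

IsNonorientableLoop : (G : RibbonGraph) → Edge G → Set
IsNonorientableLoop G e = IsLoop G e × tw (pre G) e ≡ true

record Cycle (G : RibbonGraph) : Set where
  field
    len    : ℕ
    es     : Fin (suc len) → Edge G
    vs     : Fin (suc len) → Vertex G
    esInj  : ∀ i j → es i ≡ es j → i ≡ j
    vsInj  : ∀ i j → vs i ≡ vs j → i ≡ j
    joins  : ∀ i → Joins G (es i) (vs i) (vs (next i))
open Cycle public

InCycle : {G : RibbonGraph} → Edge G → Cycle G → Set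
InCycle c C = ∃ λ i → es C i ≡ c

-- loop e interlaced with C: around its vertex one sees e c1 e c2
-- with c1, c2 edges of C
Interlaced : (G : RibbonGraph) → Edge G → Cycle G → Set
Interlaced G e C =
  Σ (Vertex G) λ v →
  Σ (Fin (length (rot (pre G) v))) λ i →
  Σ (Fin (length (rot (pre G) v))) λ j →
    toℕ i < toℕ j ×
    proj₁ (lookup (rot (pre G) v) i) ≡ e ×
    proj₁ (lookup (rot (pre G) v) j) ≡ e ×
    (∃ λ m → toℕ i < toℕ m × toℕ m < toℕ j ×
             InCycle (proj₁ (lookup (rot (pre G) v) m)) C) ×
    (∃ λ m → (toℕ m < toℕ i ⊎ toℕ m > toℕ j) ×
             InCycle (proj₁ (lookup (rot (pre G) v) m)) C)

IsTrivialLoop : (G : RibbonGraph) → Edge G → Set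
IsTrivialLoop G e = IsLoop G e × (∀ (C : Cycle G) → ¬ Interlaced G e C)

-- A partition lies in Q(G) when Q = G^{τ(Z)} \ Y has k(G) boundary components. Each boundary
-- component stays inside one component of Q, hence of G, so b(Q) ≥ k(G) always.
--
-- If e is a bridge in Y, Q has at least k(G \ e) > k(G) components. If e is a
-- trivial loop at v, kept and untwisted in Q (dot when orientable, hat when not), split v into the
-- corners inside and outside e: every boundary arc respects the split, and the two corners at one
-- end of e lie on opposite sides. They can only be joined if the split graph joins the two sides,
-- i.e. if some cycle is interlaced with e; hence b(Q) > k(G).
--
-- Grow a spanning tree with Prim's algorithm from a subgraph whose boundary is connected
-- around every vertex; attaching a pendant edge preserves this, and at the end b(Q) = k(G). Start
-- from nothing, avoiding e, when e is not a bridge; from e when e is not a loop; and, when the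
-- loop e is interlaced with a cycle, from e together with that cycle, untwisted: since the cycle
-- crosses e, the boundary of this subgraph is connected around each vertex.

module Submission where

open import Defs
open import Data.Nat as ℕ using (ℕ; zero; suc; _+_; _∸_; _<_; _≤_; _>_; z≤n; s≤s)
import Data.Nat.Properties as ℕₚ
open import Data.Fin as Fin using (Fin; toℕ; zero; suc; fromℕ; fromℕ<; inject₁; punchIn; punchOut)
import Data.Fin.Properties as Finₚ
import Data.Fin.Induction
open import Data.Nat.DivMod using (_%_; m<n⇒m%n≡m; n%n≡0)
open import Data.Bool using (Bool; true; false; not; if_then_else_; _∨_; _∧_; _xor_)
import Data.Bool.Properties as Boolₚ
open import Data.List using (List; []; _∷_; length; lookup)
open import Data.List.Membership.Propositional using (_∈_)
open import Data.List.Relation.Unary.All as All using (All; []; _∷_)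
open import Data.List.Relation.Unary.Any using (here; there)
open import Data.Product using (Σ; ∃; _×_; _,_; proj₁; proj₂)
import Data.Product.Properties
open import Data.Sum using (_⊎_; inj₁; inj₂; [_,_]; [_,_]′)
open import Data.Empty using (⊥; ⊥-elim)
open import Function using (id; _∘_)
open import Function.Bundles using (_⇔_; mk⇔)
open import Relation.Nullary using (¬_; Dec; yes; no; does)
open import Relation.Nullary.Decidable as Dec using (_×-dec_; _⊎-dec_; dec-true; dec-false)
open import Relation.Binary using (tri<; tri≈; tri>)
open import Relation.Binary.PropositionalEquality using (_≡_; _≢_; refl; sym; trans; cong; cong₂; subst; subst₂)
open import Axiom.UniquenessOfIdentityProofs.WithK using (uip)
open import Relation.Binary.Construct.Closure.ReflexiveTransitive using (ε; _◅_; _◅◅_; fold; kleisliStar; reverse)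

-- Connectivity and counting classes

module _ {A : Set} {R : A → A → Set} where

  Conn-return : ∀ {a b} → R a b → Conn R a b
  Conn-return r = inj₁ r ◅ ε

  Conn-return˘ : ∀ {a b} → R b a → Conn R a b
  Conn-return˘ r = inj₂ r ◅ ε

  Conn-sym : ∀ {a b} → Conn R a b → Conn R b a
  Conn-sym = reverse Data.Sum.swap

  ≡⇒Conn : ∀ {a b} → a ≡ b → Conn R a b
  ≡⇒Conn refl = ε

  Conn-invariant : ∀ {B : Set} (f : A → B) → (∀ {x y} → R x y → f x ≡ f y) →
                   ∀ {x y} → Conn R x y → f x ≡ f y
  Conn-invariant f h = fold (λ x y → f x ≡ f y) (λ r q → trans ([ h , sym ∘ h ] r) q) refl

Conn-map : ∀ {A B : Set} {R : A → A → Set} {S : B → B → Set} (f : A → B) →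
           (∀ {a b} → R a b → Conn S (f a) (f b)) →
           ∀ {a b} → Conn R a b → Conn S (f a) (f b)
Conn-map f h = kleisliStar f [ h , Conn-sym ∘ h ]

Conn-mono : ∀ {A : Set} {R S : A → A → Set} →
            (∀ {a b} → R a b → Conn S a b) → ∀ {a b} → Conn R a b → Conn S a b
Conn-mono = Conn-map id

surjective⇒≤ : ∀ {a b} (φ : Fin a → Fin b) → (∀ j → ∃ λ i → φ i ≡ j) → b ≤ a
surjective⇒≤ φ s = Finₚ.injective⇒≤ {f = proj₁ ∘ s}
  (λ {j} {j'} eq → trans (sym (proj₂ (s j))) (trans (cong φ eq) (proj₂ (s j'))))

injective∧missing⇒< : ∀ {a b} (ψ : Fin b → Fin a) → (∀ {j j'} → ψ j ≡ ψ j' → j ≡ j') →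
                      (k : Fin a) → (∀ j → ψ j ≢ k) → b < a
injective∧missing⇒< {suc a} ψ inj k miss =
  s≤s (Finₚ.injective⇒≤ {f = λ j → punchOut (miss j ∘ sym)}
                        (λ {j} {j'} eq → inj (Finₚ.punchOut-injective (miss j ∘ sym) (miss j' ∘ sym) eq)))

module _ {a b} (φ : Fin a → Fin b) (s : ∀ j → ∃ λ i → φ i ≡ j) where
  private
    ψ : Fin b → Fin a
    ψ = proj₁ ∘ s

    ψ-injective : ∀ {j j'} → ψ j ≡ ψ j' → j ≡ j'
    ψ-injective {j} {j'} eq = trans (sym (proj₂ (s j))) (trans (cong φ eq) (proj₂ (s j')))

    φ∘ψ : ∀ j {x} → ψ j ≡ x → φ x ≡ j
    φ∘ψ j refl = proj₂ (s j)

  -- The section ψ of φ misses one of any two points identified by φ.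
  surjective∧collision⇒< : ∀ {i i'} → i ≢ i' → φ i ≡ φ i' → b < a
  surjective∧collision⇒< {i} {i'} i≢i' φi≡φi' with ψ (φ i) Fin.≟ i
  ... | yes ψφi≡i = injective∧missing⇒< ψ ψ-injective i'
                      (λ j ψj≡i' → i≢i' (trans (sym ψφi≡i) (trans (cong ψ (trans φi≡φi' (φ∘ψ j ψj≡i'))) ψj≡i')))
  ... | no ψφi≢i = injective∧missing⇒< ψ ψ-injective i
                     (λ j ψj≡i → ψφi≢i (subst (λ z → ψ z ≡ i) (sym (φ∘ψ j ψj≡i)) ψj≡i))

-- f induces a surjection from the R-classes onto the S-classes.
module ClassMap {A B : Set} {R : A → A → Set} {S : B → B → Set} {a b : ℕ}
                (HA : HasClasses A R a) (HB : HasClasses B S b) (f : A → B)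
                (resp : ∀ {x y} → R x y → Conn S (f x) (f y))
                (hit : ∀ y → ∃ λ x → Conn S (f x) y) where
  private
    rA : Fin a → A
    rA = proj₁ HA
    coverA : ∀ x → ∃ λ i → Conn R x (rA i)
    coverA = proj₂ (proj₂ HA)
    rB : Fin b → B
    rB = proj₁ HB
    distinctB : ∀ i j → Conn S (rB i) (rB j) → i ≡ j
    distinctB = proj₁ (proj₂ HB)
    coverB : ∀ y → ∃ λ j → Conn S y (rB j)
    coverB = proj₂ (proj₂ HB)

    φ : Fin a → Fin b
    φ i = proj₁ (coverB (f (rA i)))

    φ-surjective : ∀ j → ∃ λ i → φ i ≡ j
    φ-surjective j =
      let (x , fx~rj) = hit (rB j) ; (i , x~ri) = coverA x in
      i , distinctB _ _ (Conn-sym (proj₂ (coverB (f (rA i)))) ◅◅ Conn-map f resp (Conn-sym x~ri) ◅◅ fx~rj)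

  classes-≤ : b ≤ a
  classes-≤ = surjective⇒≤ φ φ-surjective

  classes-< : (x₁ x₂ : A) → ¬ Conn R x₁ x₂ → Conn S (f x₁) (f x₂) → b < a
  classes-< x₁ x₂ x₁≁x₂ fx₁~fx₂ = surjective∧collision⇒< φ φ-surjective i₁≢i₂ φi₁≡φi₂
    where
    i₁ i₂ : Fin a
    i₁ = proj₁ (coverA x₁)
    i₂ = proj₁ (coverA x₂)
    i₁≢i₂ : i₁ ≢ i₂
    i₁≢i₂ eq = x₁≁x₂ (proj₂ (coverA x₁) ◅◅ ≡⇒Conn (cong rA eq) ◅◅ Conn-sym (proj₂ (coverA x₂)))
    φi₁≡φi₂ : φ i₁ ≡ φ i₂
    φi₁≡φi₂ = distinctB _ _ (Conn-sym (proj₂ (coverB (f (rA i₁)))) ◅◅ Conn-map f resp (Conn-sym (proj₂ (coverA x₁)))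
                              ◅◅ fx₁~fx₂ ◅◅ Conn-map f resp (proj₂ (coverA x₂)) ◅◅ proj₂ (coverB (f (rA i₂))))

open ClassMap using (classes-≤; classes-<) public

classes-unique : ∀ {A : Set} {R : A → A → Set} {a b} → HasClasses A R a → HasClasses A R b → a ≡ b
classes-unique HA HB = ℕₚ.≤-antisym (classes-≤ HB HA id Conn-return (λ y → y , ε))
                                    (classes-≤ HA HB id Conn-return (λ y → y , ε))

-- Classes of finite edge relations

record Labelling (N : ℕ) (R : Fin N → Fin N → Set) : Set where
  field
    k          : ℕ
    label      : Fin N → Fin k
    label-resp : ∀ {x y} → Conn R x y → label x ≡ label y
    label-conn : ∀ {x y} → label x ≡ label y → Conn R x y
    label-surj : ∀ c → ∃ λ x → label x ≡ c

  classes : HasClasses (Fin N) R k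
  classes = (λ c → proj₁ (label-surj c))
          , (λ i j c → trans (sym (proj₂ (label-surj i))) (trans (label-resp c) (proj₂ (label-surj j))))
          , (λ x → label x , label-conn (sym (proj₂ (label-surj (label x)))))

  Conn? : ∀ x y → Dec (Conn R x y)
  Conn? x y with label x Fin.≟ label y
  ... | yes eq = yes (label-conn eq)
  ... | no neq = no (neq ∘ label-resp)

labelling-⇔ : ∀ {N} {R S : Fin N → Fin N → Set} → Labelling N R →
              (∀ {a b} → R a b → Conn S a b) → (∀ {a b} → S a b → Conn R a b) → Labelling N S
labelling-⇔ L R⇒S S⇒R = record
  { k = k ; label = label ; label-resp = label-resp ∘ Conn-mono S⇒R
  ; label-conn = Conn-mono R⇒S ∘ label-conn ; label-surj = label-surj }
  where open Labelling L

labelling-∅ : ∀ N → Labelling N (λ _ _ → ⊥)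
labelling-∅ N = record
  { k = N ; label = id ; label-resp = Conn-invariant id (λ ()) ; label-conn = ≡⇒Conn
  ; label-surj = λ c → c , refl }

WithEdge : ∀ {N} → (Fin N → Fin N → Set) → Fin N → Fin N → Fin N → Fin N → Set
WithEdge R x y a b = (a ≡ x × b ≡ y) ⊎ R a b

module Merge {k : ℕ} {lx ly : Fin (suc k)} (lx≢ly : lx ≢ ly) where

  merge : Fin (suc k) → Fin k
  merge c with c Fin.≟ ly
  ... | yes _ = punchOut (lx≢ly ∘ sym)
  ... | no c≢ly = punchOut (c≢ly ∘ sym)

  merge-identifies : merge lx ≡ merge ly
  merge-identifies with lx Fin.≟ ly | ly Fin.≟ ly
  ... | yes lx≡ly | _ = ⊥-elim (lx≢ly lx≡ly)
  ... | no _ | yes _ = Finₚ.punchOut-cong ly refl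
  ... | no _ | no ly≢ly = ⊥-elim (ly≢ly refl)

  merge-fibres : ∀ c c' → merge c ≡ merge c' → c ≡ c' ⊎ ((c ≡ lx × c' ≡ ly) ⊎ (c ≡ ly × c' ≡ lx))
  merge-fibres c c' eq with c Fin.≟ ly | c' Fin.≟ ly
  ... | yes c≡ly | yes c'≡ly = inj₁ (trans c≡ly (sym c'≡ly))
  ... | yes c≡ly | no c'≢ly = inj₂ (inj₂ (c≡ly , sym (Finₚ.punchOut-injective (lx≢ly ∘ sym) (c'≢ly ∘ sym) eq)))
  ... | no c≢ly | yes c'≡ly = inj₂ (inj₁ (Finₚ.punchOut-injective (c≢ly ∘ sym) (lx≢ly ∘ sym) eq , c'≡ly))
  ... | no c≢ly | no c'≢ly = inj₁ (Finₚ.punchOut-injective (c≢ly ∘ sym) (c'≢ly ∘ sym) eq)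

  merge-punchIn : ∀ d → merge (punchIn ly d) ≡ d
  merge-punchIn d with punchIn ly d Fin.≟ ly
  ... | yes eq = ⊥-elim (Finₚ.punchInᵢ≢i ly d eq)
  ... | no _ = trans (Finₚ.punchOut-cong ly refl) (Finₚ.punchOut-punchIn ly)

labelling-+edge : ∀ {N R} → Labelling N R → (x y : Fin N) → Labelling N (WithEdge R x y)
labelling-+edge {N} {R} L x y with Labelling.label L x Fin.≟ Labelling.label L y
... | yes lx≡ly = record
  { k = k ; label = label
  ; label-resp = Conn-invariant label (λ { (inj₁ (refl , refl)) → lx≡ly ; (inj₂ r) → label-resp (Conn-return r) })
  ; label-conn = lift ∘ label-conn ; label-surj = label-surj }
  where
  open Labelling L
  lift : ∀ {a b} → Conn R a b → Conn (WithEdge R x y) a b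
  lift = Conn-mono (Conn-return ∘ inj₂)
... | no lx≢ly = merged (Labelling.k L) (Labelling.label L) (Labelling.label-resp L)
                        (Labelling.label-conn L) (Labelling.label-surj L) lx≢ly
  where
  lift : ∀ {a b} → Conn R a b → Conn (WithEdge R x y) a b
  lift = Conn-mono (Conn-return ∘ inj₂)
  merged : ∀ k (label : Fin N → Fin k) → (∀ {a b} → Conn R a b → label a ≡ label b) →
           (∀ {a b} → label a ≡ label b → Conn R a b) → (∀ c → ∃ λ a → label a ≡ c) →
           label x ≢ label y → Labelling N (WithEdge R x y)
  merged zero label _ _ _ _ with label x
  ... | ()
  merged (suc k) label resp conn surj lx≢ly = record
    { k = k ; label = merge ∘ label
    ; label-resp = Conn-invariant (merge ∘ label)
                     (λ { (inj₁ (refl , refl)) → merge-identifies ; (inj₂ r) → cong merge (resp (Conn-return r)) })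
    ; label-conn = conn′
    ; label-surj = λ d → let (a , la) = surj (punchIn (label y) d) in a , trans (cong merge la) (merge-punchIn d) }
    where
    open Merge lx≢ly
    conn′ : ∀ {a b} → merge (label a) ≡ merge (label b) → Conn (WithEdge R x y) a b
    conn′ {a} {b} eq with merge-fibres (label a) (label b) eq
    ... | inj₁ la≡lb = lift (conn la≡lb)
    ... | inj₂ (inj₁ (la≡lx , lb≡ly)) = lift (conn la≡lx) ◅◅ Conn-return (inj₁ (refl , refl)) ◅◅ lift (conn (sym lb≡ly))
    ... | inj₂ (inj₂ (la≡ly , lb≡lx)) = lift (conn la≡ly) ◅◅ Conn-return˘ (inj₁ (refl , refl)) ◅◅ lift (conn (sym lb≡lx))

EdgeRel : ∀ {N m} → (Fin m → Bool) → (Fin m → Fin N) → (Fin m → Fin N) → Fin N → Fin N → Set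
EdgeRel {m = m} ok s t a b = Σ (Fin m) λ g → ok g ≡ true × s g ≡ a × t g ≡ b

labelling-edges : ∀ {N} m (ok : Fin m → Bool) (s t : Fin m → Fin N) → Labelling N (EdgeRel ok s t)
labelling-edges {N} zero ok s t = labelling-⇔ (labelling-∅ N) (λ ()) (λ { (() , _) })
labelling-edges (suc m) ok s t with ok zero in ok₀
... | true = labelling-⇔ (labelling-+edge (labelling-edges m (ok ∘ suc) (s ∘ suc) (t ∘ suc)) (s zero) (t zero))
               (λ { (inj₁ (refl , refl)) → Conn-return (zero , ok₀ , refl , refl)
                  ; (inj₂ (g , r)) → Conn-return (suc g , r) })
               (λ { (zero , _ , refl , refl) → Conn-return (inj₁ (refl , refl))
                  ; (suc g , r) → Conn-return (inj₂ (g , r)) })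
... | false = labelling-⇔ (labelling-edges m (ok ∘ suc) (s ∘ suc) (t ∘ suc))
                (λ (g , r) → Conn-return (suc g , r))
                (λ { (zero , okg , _) → ⊥-elim (Boolₚ.not-¬ ok₀ okg)
                   ; (suc g , r) → Conn-return (g , r) })

-- Cyclic rotations

toℕ-next-< : ∀ {n} (i : Fin n) → suc (toℕ i) < n → toℕ (next i) ≡ suc (toℕ i)
toℕ-next-< {suc n} i lt = trans (Finₚ.toℕ-fromℕ< _) (m<n⇒m%n≡m lt)

toℕ-next-last : ∀ {n} (i : Fin n) → suc (toℕ i) ≡ n → toℕ (next i) ≡ 0
toℕ-next-last {suc n} i eq = trans (Finₚ.toℕ-fromℕ< _) (trans (cong (_% suc n) eq) (n%n≡0 (suc n)))

next-injective : ∀ {n} (x y : Fin n) → next x ≡ next y → x ≡ y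
next-injective {suc n} x y eq with ℕₚ.m≤n⇒m<n∨m≡n (Finₚ.toℕ<n x) | ℕₚ.m≤n⇒m<n∨m≡n (Finₚ.toℕ<n y)
... | inj₁ x< | inj₁ y< = Finₚ.toℕ-injective (ℕₚ.suc-injective (trans (sym (toℕ-next-< x x<)) (trans (cong toℕ eq) (toℕ-next-< y y<))))
... | inj₂ x≡ | inj₂ y≡ = Finₚ.toℕ-injective (ℕₚ.suc-injective (trans x≡ (sym y≡)))
... | inj₁ x< | inj₂ y≡ = ⊥-elim (ℕₚ.0≢1+n (sym (trans (sym (toℕ-next-< x x<)) (trans (cong toℕ eq) (toℕ-next-last y y≡)))))
... | inj₂ x≡ | inj₁ y< = ⊥-elim (ℕₚ.0≢1+n (sym (trans (sym (toℕ-next-< y y<)) (trans (cong toℕ (sym eq)) (toℕ-next-last x x≡)))))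

predecessor : ∀ {L} (x : Fin L) {n} → toℕ x ≡ suc n → Σ (Fin L) λ x' → toℕ x' ≡ n × next x' ≡ x
predecessor {L} x {n} x≡1+n = x' , Finₚ.toℕ-fromℕ< n<L , Finₚ.toℕ-injective toℕ-next-x'
  where
  1+n<L : suc n < L
  1+n<L = subst (_< L) x≡1+n (Finₚ.toℕ<n x)
  n<L : n < L
  n<L = ℕₚ.<-trans (ℕₚ.n<1+n n) 1+n<L
  x' : Fin L
  x' = fromℕ< n<L
  toℕ-next-x' : toℕ (next x') ≡ toℕ x
  toℕ-next-x' = trans (toℕ-next-< x' (subst (λ m → suc m < L) (sym (Finₚ.toℕ-fromℕ< n<L)) 1+n<L))
                      (trans (cong suc (Finₚ.toℕ-fromℕ< n<L)) (sym x≡1+n))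

next-fromℕ : ∀ n → next (fromℕ n) ≡ zero
next-fromℕ n = Finₚ.toℕ-injective (toℕ-next-last (fromℕ n) (cong suc (Finₚ.toℕ-fromℕ n)))

<-suc-split : ∀ {y x' x} → x ≡ suc x' → y < x → y < x' ⊎ y ≡ x'
<-suc-split refl y<x = ℕₚ.m<1+n⇒m<n∨m≡n y<x

module FilteredPositions {X : Set} (p : X → Bool) where

  keptPos : ∀ xs → Fin (length (filterB p xs)) → Fin (length xs)
  keptPos (x ∷ xs) i with p x
  keptPos (x ∷ xs) zero    | true = zero
  keptPos (x ∷ xs) (suc i) | true = suc (keptPos xs i)
  keptPos (x ∷ xs) i       | false = suc (keptPos xs i)

  lookup-keptPos : ∀ xs i → lookup xs (keptPos xs i) ≡ lookup (filterB p xs) i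
  lookup-keptPos (x ∷ xs) i with p x
  lookup-keptPos (x ∷ xs) zero    | true = refl
  lookup-keptPos (x ∷ xs) (suc i) | true = lookup-keptPos xs i
  lookup-keptPos (x ∷ xs) i       | false = lookup-keptPos xs i

  lookup-filterB-kept : ∀ xs i → p (lookup (filterB p xs) i) ≡ true
  lookup-filterB-kept (x ∷ xs) i with p x in px
  lookup-filterB-kept (x ∷ xs) zero    | true = px
  lookup-filterB-kept (x ∷ xs) (suc i) | true = lookup-filterB-kept xs i
  lookup-filterB-kept (x ∷ xs) i       | false = lookup-filterB-kept xs i

  keptPos-mono : ∀ xs i j → toℕ i < toℕ j → toℕ (keptPos xs i) < toℕ (keptPos xs j)
  keptPos-mono (x ∷ xs) i j lt with p x
  keptPos-mono (x ∷ xs) zero    (suc j) lt       | true = s≤s z≤n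
  keptPos-mono (x ∷ xs) (suc i) (suc j) (s≤s lt) | true = s≤s (keptPos-mono xs i j lt)
  keptPos-mono (x ∷ xs) i       j       lt       | false = s≤s (keptPos-mono xs i j lt)

  keptPos-surjective : ∀ xs j → p (lookup xs j) ≡ true → Σ (Fin (length (filterB p xs))) λ i → keptPos xs i ≡ j
  keptPos-surjective (x ∷ xs) zero kept with p x
  ... | true = zero , refl
  keptPos-surjective (x ∷ xs) (suc j) kept with p x
  ... | true = let (i , eq) = keptPos-surjective xs j kept in suc i , cong suc eq
  ... | false = let (i , eq) = keptPos-surjective xs j kept in i , cong suc eq

  keptPos-mono⁻ : ∀ xs i j → toℕ (keptPos xs i) < toℕ (keptPos xs j) → toℕ i < toℕ j
  keptPos-mono⁻ xs i j lt with ℕₚ.<-cmp (toℕ i) (toℕ j)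
  ... | tri< i<j _ _ = i<j
  ... | tri≈ _ i≡j _ = ⊥-elim (ℕₚ.<-irrefl (cong (toℕ ∘ keptPos xs) (Finₚ.toℕ-injective i≡j)) lt)
  ... | tri> _ _ j<i = ⊥-elim (ℕₚ.<-asym lt (keptPos-mono xs j i j<i))

  keptPos-injective : ∀ xs i j → keptPos xs i ≡ keptPos xs j → i ≡ j
  keptPos-injective xs i j eq with ℕₚ.<-cmp (toℕ i) (toℕ j)
  ... | tri< i<j _ _ = ⊥-elim (ℕₚ.<-irrefl (cong toℕ eq) (keptPos-mono xs i j i<j))
  ... | tri≈ _ i≡j _ = Finₚ.toℕ-injective i≡j
  ... | tri> _ _ j<i = ⊥-elim (ℕₚ.<-irrefl (cong toℕ (sym eq)) (keptPos-mono xs j i j<i))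

  ∈filterB⇒∈ : ∀ xs i {x} → lookup (filterB p xs) i ≡ x → ∃ λ j → lookup xs j ≡ x
  ∈filterB⇒∈ xs i eq = keptPos xs i , trans (lookup-keptPos xs i) eq

  ∈filterB⇒kept : ∀ xs i {x} → lookup (filterB p xs) i ≡ x → p x ≡ true
  ∈filterB⇒kept xs i eq = subst (λ z → p z ≡ true) eq (lookup-filterB-kept xs i)

open FilteredPositions public

∈filterB-weaken : ∀ {X : Set} (p p' : X → Bool) xs i {x} → lookup (filterB p xs) i ≡ x → p' x ≡ true →
                  ∃ λ j → lookup (filterB p' xs) j ≡ x
∈filterB-weaken p p' xs i eq kept =
  let lk = trans (lookup-keptPos p xs i) eq
      (j , eqj) = keptPos-surjective p' xs (keptPos p xs i) (subst (λ z → p' z ≡ true) (sym lk) kept)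
  in j , trans (sym (lookup-keptPos p' xs j)) (trans (cong (lookup xs) eqj) lk)

zeroOf : ∀ {L} → Fin L → Fin L
zeroOf {suc _} _ = zero

lastOf : ∀ {L} → Fin L → Fin L
lastOf {suc m} _ = fromℕ m

toℕ-zeroOf : ∀ {L} (x : Fin L) → toℕ (zeroOf x) ≡ 0
toℕ-zeroOf {suc _} _ = refl

toℕ-lastOf : ∀ {L} (x : Fin L) → suc (toℕ (lastOf x)) ≡ L
toℕ-lastOf {suc m} x = cong suc (Finₚ.toℕ-fromℕ m)

zeroOf-irrelevant : ∀ {L} (x y : Fin L) → zeroOf x ≡ zeroOf y
zeroOf-irrelevant {suc _} _ _ = refl

next-lastOf : ∀ {L} (x : Fin L) → next (lastOf x) ≡ zeroOf x
next-lastOf {suc m} x = next-fromℕ m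

≤-lastOf : ∀ {L} (x y : Fin L) → toℕ y < toℕ (lastOf x) ⊎ y ≡ lastOf x
≤-lastOf x y with ℕₚ.m≤n⇒m<n∨m≡n (ℕₚ.≤-pred (subst (toℕ y <_) (sym (toℕ-lastOf x)) (Finₚ.toℕ<n y)))
... | inj₁ lt = inj₁ lt
... | inj₂ eq = inj₂ (Finₚ.toℕ-injective eq)

-- The corners around one vertex: corner i false / corner i true lie before / after position i of
-- the rotation. Consecutive positions are joined by vertex arcs; at a position whose edge is not
-- Present the two corners are joined directly (the edge has been deleted).
module Rotation {X : Set} {R : X → X → Set} {L : ℕ} (corner : Fin L → Bool → X)
                (vertexArc′ : ∀ i → R (corner i true) (corner (next i) false))
                (Present : Fin L → Set) (Present? : ∀ i → Dec (Present i))
                (bypass : ∀ i → ¬ Present i → R (corner i false) (corner i true)) where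

  NoneBetween : Fin L → Fin L → Set
  NoneBetween p x = ∀ y → toℕ p < toℕ y → toℕ y < toℕ x → ¬ Present y

  NoneBelow : Fin L → Set
  NoneBelow x = ∀ y → toℕ y < toℕ x → ¬ Present y

  Back : Fin L → Set
  Back x = (Σ (Fin L) λ p → Present p × toℕ p < toℕ x × NoneBetween p x × Conn R (corner x false) (corner p true))
         ⊎ (NoneBelow x × Conn R (corner x false) (corner (zeroOf x) false))

  stepBack : ∀ {x' x} → next x' ≡ x → Conn R (corner x false) (corner x' true)
  stepBack refl = Conn-return˘ (vertexArc′ _)

  back′ : ∀ n x → toℕ x ≡ n → Back x
  back′ zero x x≡0 =
    inj₂ ( (λ y y<x → ⊥-elim (ℕₚ.n≮0 (subst (toℕ y <_) x≡0 y<x)))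
         , ≡⇒Conn (cong (λ z → corner z false) (Finₚ.toℕ-injective (trans x≡0 (sym (toℕ-zeroOf x))))))
  back′ (suc n) x x≡1+n with predecessor x x≡1+n
  ... | x' , x'≡n , next-x'≡x with Present? x'
  ...   | yes present = inj₁ (x' , present , x'<x , adjacent , stepBack next-x'≡x)
    where
    x'<x : toℕ x' < toℕ x
    x'<x = subst₂ _<_ (sym x'≡n) (sym x≡1+n) (ℕₚ.n<1+n n)
    adjacent : NoneBetween x' x
    adjacent y x'<y y<x with <-suc-split (trans x≡1+n (cong suc (sym x'≡n))) y<x
    ... | inj₁ y<x' = ⊥-elim (ℕₚ.<-asym x'<y y<x')
    ... | inj₂ y≡x' = ⊥-elim (ℕₚ.<-irrefl (sym y≡x') x'<y)
  ...   | no absent = extend (back′ n x' x'≡n)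
    where
    x≡1+x' : toℕ x ≡ suc (toℕ x')
    x≡1+x' = trans x≡1+n (cong suc (sym x'≡n))
    below-x : ∀ {y} → toℕ y < toℕ x → toℕ y < toℕ x' ⊎ y ≡ x'
    below-x y<x = Data.Sum.map₂ Finₚ.toℕ-injective (<-suc-split x≡1+x' y<x)
    absent-x' : ∀ {y} → y ≡ x' → ¬ Present y
    absent-x' refl = absent
    toX' : Conn R (corner x false) (corner x' false)
    toX' = stepBack next-x'≡x ◅◅ Conn-return˘ (bypass x' absent)
    extend : Back x' → Back x
    extend (inj₁ (p , present , p<x' , between , c)) =
      inj₁ (p , present , ℕₚ.<-trans p<x' (subst (toℕ x' <_) (sym x≡1+x') (ℕₚ.n<1+n _))
           , (λ y p<y y<x → [ between y p<y , absent-x' ] (below-x y<x))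
           , toX' ◅◅ c)
    extend (inj₂ (below , c)) =
      inj₂ ( (λ y y<x → [ below y , absent-x' ] (below-x y<x))
           , toX' ◅◅ c ◅◅ ≡⇒Conn (cong (λ z → corner z false) (zeroOf-irrelevant x' x)))

  back : ∀ x → Back x
  back x = back′ (toℕ x) x refl

  wrap : ∀ x → Conn R (corner (zeroOf x) false) (corner (lastOf x) true)
  wrap x = stepBack (next-lastOf x)

  toFalse : ∀ x s → ¬ Present x → Conn R (corner x s) (corner x false)
  toFalse x false _ = ε
  toFalse x true absent = Conn-return˘ (bypass x absent)

  cover-false : Σ (Fin L) Present → ∀ x → Σ (Fin L) λ p → Present p × Conn R (corner x false) (corner p true)
  cover-false (p₀ , present₀) x with back x
  ... | inj₁ (p , present , _ , _ , c) = p , present , c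
  ... | inj₂ (_ , c) with Present? (lastOf x)
  ...   | yes present = lastOf x , present , c ◅◅ wrap x
  ...   | no absent with back (lastOf x)
  ...     | inj₁ (p , present , _ , _ , c') = p , present , c ◅◅ wrap x ◅◅ Conn-return˘ (bypass _ absent) ◅◅ c'
  ...     | inj₂ (below , _) with ≤-lastOf x p₀
  ...       | inj₁ p₀<last = ⊥-elim (below p₀ p₀<last present₀)
  ...       | inj₂ refl = ⊥-elim (absent present₀)

  cover : Σ (Fin L) Present → ∀ x s → Σ (Fin L) λ p → Present p × Conn R (corner x s) (corner p true)
  cover some x true with Present? x
  ... | yes present = x , present , ε
  ... | no absent = let (p , present , c) = cover-false some x in p , present , Conn-return˘ (bypass x absent) ◅◅ c
  cover some x false = cover-false some x

  allConnected : (p₀ : Fin L) → (∀ y → y ≢ p₀ → ¬ Present y) → ∀ x s → Conn R (corner x s) (corner p₀ true)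
  allConnected p₀ only-p₀ x s with Present? p₀
  ... | yes present₀ = let (p , present , c) = cover (p₀ , present₀) x s in c ◅◅ ≡⇒Conn (cong (λ z → corner z true) (is-p₀ p present))
    where
    is-p₀ : ∀ p → Present p → p ≡ p₀
    is-p₀ p present with p Fin.≟ p₀
    ... | yes eq = eq
    ... | no neq = ⊥-elim (only-p₀ p neq present)
  ... | no absent₀ = toZero x s ◅◅ ≡⇒Conn (cong (λ z → corner z false) (zeroOf-irrelevant x p₀)) ◅◅ Conn-sym (toZero p₀ true)
    where
    none : ∀ y → ¬ Present y
    none y with y Fin.≟ p₀
    ... | yes refl = absent₀
    ... | no neq = only-p₀ y neq
    toZero : ∀ y s → Conn R (corner y s) (corner (zeroOf y) false)
    toZero y s with back y
    ... | inj₁ (p , present , _) = ⊥-elim (none p present)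
    ... | inj₂ (_ , c) = toFalse y s (none y) ◅◅ c

  CyclicallyBetween : Fin L → Fin L → Fin L → Set
  CyclicallyBetween p q y = (toℕ p < toℕ q × toℕ p < toℕ y × toℕ y < toℕ q)
                          ⊎ (toℕ q < toℕ p × (toℕ p < toℕ y ⊎ toℕ y < toℕ q))

  segment : ∀ p q → Present p → p ≢ q → (∀ y → Present y → ¬ CyclicallyBetween p q y) →
            Conn R (corner p true) (corner q false)
  segment p q present p≢q gap with ℕₚ.<-cmp (toℕ p) (toℕ q)
  ... | tri≈ _ eq _ = ⊥-elim (p≢q (Finₚ.toℕ-injective eq))
  ... | tri< p<q _ _ with back q
  ...   | inj₂ (below , _) = ⊥-elim (below p p<q present)
  ...   | inj₁ (p' , present' , p'<q , between , c) with ℕₚ.<-cmp (toℕ p') (toℕ p)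
  ...     | tri< p'<p _ _ = ⊥-elim (between p p'<p p<q present)
  ...     | tri≈ _ eq _ = ≡⇒Conn (cong (λ z → corner z true) (sym (Finₚ.toℕ-injective eq))) ◅◅ Conn-sym c
  ...     | tri> _ _ p<p' = ⊥-elim (gap p' present' (inj₁ (p<q , p<p' , p'<q)))
  segment p q present p≢q gap | tri> _ _ q<p with back q
  ...   | inj₁ (p' , present' , p'<q , _) = ⊥-elim (gap p' present' (inj₂ (q<p , inj₂ p'<q)))
  ...   | inj₂ (_ , c) with ≤-lastOf q p
  ...     | inj₂ refl = Conn-sym (c ◅◅ wrap q)
  ...     | inj₁ p<last with back (lastOf q)
  ...       | inj₂ (below , _) = ⊥-elim (below p p<last present)
  ...       | inj₁ (p' , present' , p'<last , between , c') with ℕₚ.<-cmp (toℕ p') (toℕ p)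
  ...         | tri< p'<p _ _ = ⊥-elim (between p p'<p p<last present)
  ...         | tri> _ _ p<p' = ⊥-elim (gap p' present' (inj₂ (q<p , inj₁ p<p')))
  ...         | tri≈ _ eq _ = ≡⇒Conn (cong (λ z → corner z true) (sym (Finₚ.toℕ-injective eq)))
                   ◅◅ Conn-sym (c ◅◅ wrap q ◅◅ Conn-return˘ (bypass _ (λ present-last → gap _ present-last (inj₂ (q<p , inj₁ p<last)))) ◅◅ c')

  ¬between-start : ∀ {p q} → ¬ CyclicallyBetween p q p
  ¬between-start (inj₁ (_ , p<p , _)) = ℕₚ.<-irrefl refl p<p
  ¬between-start (inj₂ (_ , inj₁ p<p)) = ℕₚ.<-irrefl refl p<p
  ¬between-start (inj₂ (q<p , inj₂ p<q)) = ℕₚ.<-asym q<p p<q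

  ¬between-end : ∀ {p q} → ¬ CyclicallyBetween p q q
  ¬between-end (inj₁ (_ , _ , q<q)) = ℕₚ.<-irrefl refl q<q
  ¬between-end (inj₂ (q<p , inj₁ p<q)) = ℕₚ.<-asym q<p p<q
  ¬between-end (inj₂ (_ , inj₂ q<q)) = ℕₚ.<-irrefl refl q<q

  ¬between-outside : ∀ {p q y} → toℕ p < toℕ q → toℕ y ≤ toℕ p ⊎ toℕ q ≤ toℕ y → ¬ CyclicallyBetween p q y
  ¬between-outside _ (inj₁ y≤p) (inj₁ (_ , p<y , _)) = ℕₚ.<-irrefl refl (ℕₚ.<-≤-trans p<y y≤p)
  ¬between-outside _ (inj₂ q≤y) (inj₁ (_ , _ , y<q)) = ℕₚ.<-irrefl refl (ℕₚ.<-≤-trans y<q q≤y)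
  ¬between-outside p<q _ (inj₂ (q<p , _)) = ℕₚ.<-asym p<q q<p

  ¬between-inside : ∀ {p q y} → toℕ q < toℕ p → toℕ q ≤ toℕ y → toℕ y ≤ toℕ p → ¬ CyclicallyBetween p q y
  ¬between-inside q<p _ _ (inj₁ (p<q , _)) = ℕₚ.<-asym p<q q<p
  ¬between-inside _ _ y≤p (inj₂ (_ , inj₁ p<y)) = ℕₚ.<-irrefl refl (ℕₚ.<-≤-trans p<y y≤p)
  ¬between-inside _ q≤y _ (inj₂ (_ , inj₂ y<q)) = ℕₚ.<-irrefl refl (ℕₚ.<-≤-trans y<q q≤y)

  module OnlyPresent (ps : List (Fin L)) (only : ∀ y → Present y → y ∈ ps) where

    segment-among : ∀ p q → Present p → p ≢ q → All (λ y → ¬ CyclicallyBetween p q y) ps →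
                    Conn R (corner p true) (corner q false)
    segment-among p q present p≢q gaps = segment p q present p≢q (λ y present-y → All.lookup gaps (only y present-y))

    cover-among : Σ (Fin L) Present → ∀ x s → Σ (Fin L) λ p → p ∈ ps × Conn R (corner x s) (corner p true)
    cover-among some x s = let (p , present , c) = cover some x s in p , only p present , c

  module TwoPresent (p q : Fin L) (p≢q : p ≢ q) (present-p : Present p) (present-q : Present q)
                    (only : ∀ y → Present y → y ∈ p ∷ q ∷ []) where
    open OnlyPresent (p ∷ q ∷ []) only

    p→q : Conn R (corner p true) (corner q false)
    p→q = segment-among p q present-p p≢q (¬between-start ∷ ¬between-end ∷ [])

    q→p : Conn R (corner q true) (corner p false)
    q→p = segment-among q p present-q (p≢q ∘ sym) (¬between-end ∷ ¬between-start ∷ [])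

    two-cover : ∀ x s → Conn R (corner x s) (corner p true) ⊎ Conn R (corner x s) (corner q true)
    two-cover x s with cover-among (p , present-p) x s
    ... | _ , here refl , c = inj₁ c
    ... | _ , there (here refl) , c = inj₂ c

  module FourPresent (lo m₁ hi m₂ : Fin L) (lo<m₁ : toℕ lo < toℕ m₁) (m₁<hi : toℕ m₁ < toℕ hi)
                     (m₂-outside : toℕ m₂ < toℕ lo ⊎ toℕ hi < toℕ m₂)
                     (present-lo : Present lo) (present-m₁ : Present m₁) (present-hi : Present hi) (present-m₂ : Present m₂)
                     (only : ∀ y → Present y → y ∈ lo ∷ m₁ ∷ hi ∷ m₂ ∷ []) where
    open OnlyPresent (lo ∷ m₁ ∷ hi ∷ m₂ ∷ []) only

    private
      lo<hi : toℕ lo < toℕ hi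
      lo<hi = ℕₚ.<-trans lo<m₁ m₁<hi
      <⇒≢ : ∀ {a b : Fin L} → toℕ a < toℕ b → a ≢ b
      <⇒≢ a<b refl = ℕₚ.<-irrefl refl a<b
      >⇒≢ : ∀ {a b : Fin L} → toℕ b < toℕ a → a ≢ b
      >⇒≢ b<a refl = ℕₚ.<-irrefl refl b<a
      ≤ : ∀ {m n} → m < n → m ≤ n
      ≤ = ℕₚ.<⇒≤

    lo→m₁ : Conn R (corner lo true) (corner m₁ false)
    lo→m₁ = segment-among lo m₁ present-lo (<⇒≢ lo<m₁)
      (¬between-start ∷ ¬between-end ∷ ¬between-outside lo<m₁ (inj₂ (≤ m₁<hi)) ∷ m₂-gap ∷ [])
      where
      m₂-gap : ¬ CyclicallyBetween lo m₁ m₂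
      m₂-gap = [ (λ m₂<lo → ¬between-outside lo<m₁ (inj₁ (≤ m₂<lo)))
               , (λ hi<m₂ → ¬between-outside lo<m₁ (inj₂ (≤ (ℕₚ.<-trans m₁<hi hi<m₂)))) ] m₂-outside

    m₁→hi : Conn R (corner m₁ true) (corner hi false)
    m₁→hi = segment-among m₁ hi present-m₁ (<⇒≢ m₁<hi)
      (¬between-outside m₁<hi (inj₁ (≤ lo<m₁)) ∷ ¬between-start ∷ ¬between-end ∷ m₂-gap ∷ [])
      where
      m₂-gap : ¬ CyclicallyBetween m₁ hi m₂
      m₂-gap = [ (λ m₂<lo → ¬between-outside m₁<hi (inj₁ (≤ (ℕₚ.<-trans m₂<lo lo<m₁))))
               , (λ hi<m₂ → ¬between-outside m₁<hi (inj₂ (≤ hi<m₂))) ] m₂-outside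

    hi→m₂ : Conn R (corner hi true) (corner m₂ false)
    hi→m₂ = by-side m₂-outside
      where
      by-side : toℕ m₂ < toℕ lo ⊎ toℕ hi < toℕ m₂ → Conn R (corner hi true) (corner m₂ false)
      by-side (inj₂ hi<m₂) = segment-among hi m₂ present-hi (<⇒≢ hi<m₂)
        (¬between-outside hi<m₂ (inj₁ (≤ lo<hi)) ∷ ¬between-outside hi<m₂ (inj₁ (≤ m₁<hi)) ∷ ¬between-start ∷ ¬between-end ∷ [])
      by-side (inj₁ m₂<lo) = segment-among hi m₂ present-hi (>⇒≢ m₂<hi)
        (¬between-inside m₂<hi (≤ m₂<lo) (≤ lo<hi) ∷ ¬between-inside m₂<hi (≤ (ℕₚ.<-trans m₂<lo lo<m₁)) (≤ m₁<hi)
          ∷ ¬between-start ∷ ¬between-end ∷ [])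
        where m₂<hi = ℕₚ.<-trans m₂<lo lo<hi

    m₂→lo : Conn R (corner m₂ true) (corner lo false)
    m₂→lo = by-side m₂-outside
      where
      by-side : toℕ m₂ < toℕ lo ⊎ toℕ hi < toℕ m₂ → Conn R (corner m₂ true) (corner lo false)
      by-side (inj₁ m₂<lo) = segment-among m₂ lo present-m₂ (<⇒≢ m₂<lo)
        (¬between-end ∷ ¬between-outside m₂<lo (inj₂ (≤ lo<m₁)) ∷ ¬between-outside m₂<lo (inj₂ (≤ lo<hi)) ∷ ¬between-start ∷ [])
      by-side (inj₂ hi<m₂) = segment-among m₂ lo present-m₂ (>⇒≢ lo<m₂)
        (¬between-end ∷ ¬between-inside lo<m₂ (≤ lo<m₁) (≤ (ℕₚ.<-trans m₁<hi hi<m₂))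
          ∷ ¬between-inside lo<m₂ (≤ lo<hi) (≤ hi<m₂) ∷ ¬between-start ∷ [])
        where lo<m₂ = ℕₚ.<-trans lo<hi hi<m₂

    four-cover : ∀ x s → Σ (Fin L) λ p → p ∈ lo ∷ m₁ ∷ hi ∷ m₂ ∷ [] × Conn R (corner x s) (corner p true)
    four-cover = cover-among (lo , present-lo)

-- Boundaries of ribbon subgraphs

insert : ∀ {n} → (Fin n → Bool) → Fin n → Fin n → Bool
insert S f g = does (g Fin.≟ f) ∨ S g

insert-self : ∀ {n} (S : Fin n → Bool) f → insert S f f ≡ true
insert-self S f = cong (_∨ S f) (dec-true (f Fin.≟ f) refl)

insert-mono : ∀ {n} (S : Fin n → Bool) f g → S g ≡ true → insert S f g ≡ true
insert-mono S f g Sg = trans (cong (does (g Fin.≟ f) ∨_) Sg) (Boolₚ.∨-zeroʳ _)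

insert-false : ∀ {n} (S : Fin n → Bool) f g → insert S f g ≡ false → S g ≡ false
insert-false S f g eq = Boolₚ.¬-not (λ Sg → Boolₚ.not-¬ eq (insert-mono S f g Sg))

insert-inv : ∀ {n} (S : Fin n → Bool) f g → insert S f g ≡ true → g ≡ f ⊎ S g ≡ true
insert-inv S f g eq with g Fin.≟ f
... | yes g≡f = inj₁ g≡f
... | no _ = inj₂ eq

module Boundary (Q : PreRibbon) where

  Vert : Set
  Vert = Fin (nV Q)

  Pos : Vert → Set
  Pos v = Fin (length (rot Q v))

  edgeAt : (v : Vert) → Pos v → Fin (nE Q)
  edgeAt v i = proj₁ (lookup (rot Q v) i)

  vertexOf : BPoint Q → Vert
  vertexOf (inj₁ (v , _)) = v
  vertexOf (inj₂ (v , _)) = v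

  corner : (v : Vert) → Pos v → Bool → BPoint Q
  corner v i s = inj₁ (v , i , s)

  BRel⇒Adj : ∀ {x y} → BRel Q x y → Conn (Adj Q) (vertexOf x) (vertexOf y)
  BRel⇒Adj (arc (vertexArc v i)) = ε
  BRel⇒Adj (arc (edgeArc v i v' i' e s l₁ l₂)) = Conn-return (e , (i , l₁) , (i' , l₂))

  private
    pointAt′ : ∀ v l → rot Q v ≡ l → Σ (BPoint Q) λ x → vertexOf x ≡ v
    pointAt′ v [] eq = inj₂ (v , eq) , refl
    pointAt′ v (_ ∷ _) eq = inj₁ (v , subst (λ l → Fin (length l)) (sym eq) zero , false) , refl

  pointAt : Vert → BPoint Q
  pointAt v = proj₁ (pointAt′ v (rot Q v) refl)

  vertexOf-pointAt : ∀ v → vertexOf (pointAt v) ≡ v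
  vertexOf-pointAt v = proj₂ (pointAt′ v (rot Q v) refl)

  -- The boundary of the ribbon subgraph keeping only the edges in S, drawn on the corners of Q:
  -- the two corners at an edge outside S are joined directly.
  data Bypassed (S : Fin (nE Q) → Bool) : BPoint Q → BPoint Q → Set where
    vertexArc : ∀ v i → Bypassed S (corner v i true) (corner v (next i) false)
    edgeArc   : ∀ v i v' i' e s → S e ≡ true → lookup (rot Q v) i ≡ (e , false) → lookup (rot Q v') i' ≡ (e , true) →
                Bypassed S (corner v i s) (corner v' i' (if tw Q e then s else not s))
    bypass    : ∀ v i → S (edgeAt v i) ≡ false → Bypassed S (corner v i false) (corner v i true)

  Bypassed⇒BRel : ∀ S → (∀ v i → S (edgeAt v i) ≡ true) → ∀ {x y} → Bypassed S x y → BRel Q x y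
  Bypassed⇒BRel S all (vertexArc v i) = arc (vertexArc v i)
  Bypassed⇒BRel S all (edgeArc v i v' i' e s _ l₁ l₂) = arc (edgeArc v i v' i' e s l₁ l₂)
  Bypassed⇒BRel S all (bypass v i out) = ⊥-elim (Boolₚ.not-¬ out (all v i))

  LocallyConnected : (Fin (nE Q) → Bool) → Set
  LocallyConnected S = ∀ x y → vertexOf x ≡ vertexOf y → Conn (Bypassed S) x y

  module AtVertex (S : Fin (nE Q) → Bool) (w : Vert) =
    Rotation {R = Bypassed S} (corner w) (vertexArc w) (λ i → S (edgeAt w i) ≡ true) (λ i → S (edgeAt w i) Boolₚ.≟ true)
             (λ i absent → bypass w i (Boolₚ.¬-not absent))

  AtMostOne : (Fin (nE Q) → Bool) → Vert → Set
  AtMostOne S w = ∀ j j' → S (edgeAt w j) ≡ true → S (edgeAt w j') ≡ true → j ≡ j'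

  connected-at : ∀ S w → AtMostOne S w → ∀ i s j s' → Conn (Bypassed S) (corner w i s) (corner w j s')
  connected-at S w amo i s j s' with Finₚ.any? (λ k → S (edgeAt w k) Boolₚ.≟ true)
  ... | yes (p₀ , in₀) = allConnected p₀ (λ y y≢p₀ in-y → y≢p₀ (amo y p₀ in-y in₀)) i s
                         ◅◅ Conn-sym (allConnected p₀ (λ y y≢p₀ in-y → y≢p₀ (amo y p₀ in-y in₀)) j s')
    where open AtVertex S w
  ... | no none = allConnected i (λ y _ in-y → none (y , in-y)) i s ◅◅ Conn-sym (allConnected i (λ y _ in-y → none (y , in-y)) j s')
    where open AtVertex S w

  LocallyConnected-corners : ∀ S → (∀ w i s j s' → Conn (Bypassed S) (corner w i s) (corner w j s')) → LocallyConnected S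
  LocallyConnected-corners S h (inj₁ (v , i , s)) (inj₁ (.v , j , s')) refl = h v i s j s'
  LocallyConnected-corners S h (inj₁ (v , i , s)) (inj₂ (.v , eq)) refl = ⊥-elim (Finₚ.¬Fin0 (subst (λ l → Fin (length l)) eq i))
  LocallyConnected-corners S h (inj₂ (v , eq)) (inj₁ (.v , j , s')) refl = ⊥-elim (Finₚ.¬Fin0 (subst (λ l → Fin (length l)) eq j))
  LocallyConnected-corners S h (inj₂ (v , eq)) (inj₂ (.v , eq')) refl = ≡⇒Conn (cong (λ z → inj₂ (v , z)) (uip eq eq'))

  LocallyConnected-atMostOne : ∀ S → (∀ w → AtMostOne S w) → LocallyConnected S
  LocallyConnected-atMostOne S amo = LocallyConnected-corners S (λ w → connected-at S w (amo w))

  setSide : BPoint Q → Bool → BPoint Q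
  setSide (inj₁ (v , i , _)) s = inj₁ (v , i , s)
  setSide (inj₂ x) s = inj₂ x

  -- At the new vertex pb only f is present, so all corners of pb are connected; this replaces
  -- the bypass between the two corners at f.
  LocallyConnected-attach : ∀ S f → S f ≡ false →
    (pa : Vert) (ia : Pos pa) (pb : Vert) (ib : Pos pb) →
    (ends : ∀ v i → edgeAt v i ≡ f → corner v i false ≡ corner pa ia false ⊎ corner v i false ≡ corner pb ib false) →
    (fresh : ∀ j → S (edgeAt pb j) ≡ false) →
    (only-f : ∀ j → edgeAt pb j ≡ f → j ≡ ib) →
    (link : ∀ s → Σ Bool λ s' → Conn (Bypassed (insert S f)) (corner pa ia s) (corner pb ib s')) →
    LocallyConnected S → LocallyConnected (insert S f)
  LocallyConnected-attach S f Sf≡false pa ia pb ib ends fresh only-f link lc x y eq = Conn-mono lift (lc x y eq)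
    where
    at-pb : ∀ i s j s' → Conn (Bypassed (insert S f)) (corner pb i s) (corner pb j s')
    at-pb = connected-at (insert S f) pb (λ j j' in-j in-j' → trans (is-ib j in-j) (sym (is-ib j' in-j')))
      where
      is-ib : ∀ j → insert S f (edgeAt pb j) ≡ true → j ≡ ib
      is-ib j in-j with insert-inv S f (edgeAt pb j) in-j
      ... | inj₁ eq = only-f j eq
      ... | inj₂ in-S = ⊥-elim (Boolₚ.not-¬ (fresh j) in-S)
    lift : ∀ {x y} → Bypassed S x y → Conn (Bypassed (insert S f)) x y
    lift (vertexArc v i) = Conn-return (vertexArc v i)
    lift (edgeArc v i v' i' e s Se l₁ l₂) = Conn-return (edgeArc v i v' i' e s (insert-mono S f e Se) l₁ l₂)
    lift (bypass v i out) with edgeAt v i Fin.≟ f in eq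
    ... | no _ = Conn-return (bypass v i (subst (λ d → does d ∨ S (edgeAt v i) ≡ false) (sym eq) out))
    ... | yes is-f with ends v i is-f
    ...   | inj₁ at-a = ≡⇒Conn at-a ◅◅ proj₂ (link false) ◅◅ at-pb ib _ ib _ ◅◅ Conn-sym (proj₂ (link true))
                        ◅◅ ≡⇒Conn (sym (cong (λ z → setSide z true) at-a))
    ...   | inj₂ at-b = ≡⇒Conn at-b ◅◅ at-pb ib false ib true ◅◅ ≡⇒Conn (sym (cong (λ z → setSide z true) at-b))

module RibbonGraphFacts (G : RibbonGraph) where

  P : PreRibbon
  P = pre G

  E Vx HE : Set
  E = Fin (nE P)
  Vx = Fin (nV P)
  HE = HalfEdge (nE P)

  -- Sub Z Y is G^{τ(Z)} \ Y; its rotations do not depend on Z.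
  Sub : (Z Y : E → Bool) → PreRibbon
  Sub Z Y = deleteEdges (partialPetrial P Z) Y

  kept : (E → Bool) → HE → Bool
  kept Y h = not (Y (proj₁ h))

  ofPartition : Partition G → PreRibbon
  ofPartition p = Sub (isHat ∘ p) (isBar ∘ p)

  Adj-Sub-mono : ∀ Z Y Z' Y' → (∀ g → Y' g ≡ true → Y g ≡ true) → ∀ {v w} → Adj (Sub Z Y) v w → Adj (Sub Z' Y') v w
  Adj-Sub-mono Z Y Z' Y' Y'⊆Y {v} {w} (g , (i , l₁) , (j , l₂)) =
    g , ∈filterB-weaken (kept Y) (kept Y') (rot P v) i l₁ (still-kept (∈filterB⇒kept (kept Y) (rot P v) i l₁))
      , ∈filterB-weaken (kept Y) (kept Y') (rot P w) j l₂ (still-kept (∈filterB⇒kept (kept Y) (rot P w) j l₂))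
    where
    still-kept : not (Y g) ≡ true → not (Y' g) ≡ true
    still-kept kept-g with Y' g in eq
    ... | false = refl
    ... | true = subst (λ z → not z ≡ true) (Y'⊆Y g eq) kept-g

  Adj-Sub⇒Adj : ∀ Z Y {v w} → Adj (Sub Z Y) v w → Adj P v w
  Adj-Sub⇒Adj Z Y {v} {w} (g , (i , l₁) , (j , l₂)) =
    g , ∈filterB⇒∈ (kept Y) (rot P v) i l₁ , ∈filterB⇒∈ (kept Y) (rot P w) j l₂

  bridge⇒bar-singular : ∀ e → IsBridge G e → Singular G e bar
  bridge⇒bar-singular e (a , b , CCa , CCb , a<b) (p , (n , BC , CCn) , pe≡bar) =
    ℕₚ.<-irrefl refl (ℕₚ.<-≤-trans a<b (subst (b ≤_) (sym (classes-unique CCa CCn)) b≤n))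
    where
    open Boundary (ofPartition p)
    e-deleted : ∀ g → does (g Fin.≟ e) ≡ true → isBar (p g) ≡ true
    e-deleted g d with g Fin.≟ e
    ... | yes refl = cong isBar pe≡bar
    b≤n : b ≤ n
    b≤n = classes-≤ BC CCb vertexOf
            (Conn-mono (Conn-return ∘ Adj-Sub-mono (isHat ∘ p) (isBar ∘ p) (λ _ → false) (λ f → does (f Fin.≟ e)) e-deleted) ∘ BRel⇒Adj)
            (λ v → pointAt v , ≡⇒Conn (vertexOf-pointAt v))

  home : HE → Vx
  home h = proj₁ (occurs G h)

  homePos : (h : HE) → Fin (length (rot P (home h)))
  homePos h = proj₁ (proj₂ (occurs G h))

  lookup-homePos : ∀ h → lookup (rot P (home h)) (homePos h) ≡ h
  lookup-homePos h = proj₂ (proj₂ (occurs G h))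

  home-unique : ∀ {v i h} → lookup (rot P v) i ≡ h → v ≡ home h
  home-unique {v} {i} {h} eq = proj₁ (occUniq G v (home h) i (homePos h) (trans eq (sym (lookup-homePos h))))

  Adj⇒edge : ∀ {u w} → Adj P u w → Σ E λ g → home (g , false) ≡ u × home (g , true) ≡ w
  Adj⇒edge (g , (i , l₁) , (j , l₂)) = g , sym (home-unique l₁) , sym (home-unique l₂)

  Sub-occUniq : ∀ Z Y v w (i : Fin (length (rot (Sub Z Y) v))) (j : Fin (length (rot (Sub Z Y) w))) →
                lookup (rot (Sub Z Y) v) i ≡ lookup (rot (Sub Z Y) w) j → v ≡ w × toℕ i ≡ toℕ j
  Sub-occUniq Z Y v w i j eq with occUniq G v w (keptPos (kept Y) (rot P v) i) (keptPos (kept Y) (rot P w) j)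
                                    (trans (lookup-keptPos (kept Y) (rot P v) i) (trans eq (sym (lookup-keptPos (kept Y) (rot P w) j))))
  ... | refl , eqℕ = refl , cong toℕ (keptPos-injective (kept Y) (rot P v) i j (Finₚ.toℕ-injective eqℕ))

  Sub-pos-injective : ∀ Z Y v (i j : Fin (length (rot (Sub Z Y) v))) →
                      lookup (rot (Sub Z Y) v) i ≡ lookup (rot (Sub Z Y) v) j → i ≡ j
  Sub-pos-injective Z Y v i j eq = Finₚ.toℕ-injective (proj₂ (Sub-occUniq Z Y v v i j eq))

  Sub-homePos : ∀ Z Y h → Y (proj₁ h) ≡ false → Σ (Fin (length (rot (Sub Z Y) (home h)))) λ q →
                lookup (rot (Sub Z Y) (home h)) q ≡ h × keptPos (kept Y) (rot P (home h)) q ≡ homePos h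
  Sub-homePos Z Y h not-deleted =
    let (q , eq) = keptPos-surjective (kept Y) (rot P (home h)) (homePos h)
                     (trans (cong (kept Y) (lookup-homePos h)) (cong not not-deleted))
    in q , trans (sym (lookup-keptPos (kept Y) (rot P (home h)) q)) (trans (cong (lookup (rot P (home h))) eq) (lookup-homePos h)) , eq

does-⇔ : ∀ {X Y : Set} (x : Dec X) (y : Dec Y) → (X → Y) → (Y → X) → does x ≡ does y
does-⇔ (yes _) (yes _) _ _ = refl
does-⇔ (yes x) (no ¬y) to _ = ⊥-elim (¬y (to x))
does-⇔ (no ¬x) (yes y) _ from = ⊥-elim (¬x (from y))
does-⇔ (no _) (no _) _ _ = refl

does⇒ : ∀ {X : Set} (d : Dec X) → does d ≡ true → X
does⇒ (yes x) _ = x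

if-does-yes : ∀ {X A : Set} {a b : A} (d : Dec X) → X → (if does d then a else b) ≡ a
if-does-yes {a = a} {b} d x = cong (if_then a else b) (dec-true d x)

if-does-no : ∀ {X A : Set} {a b : A} (d : Dec X) → ¬ X → (if does d then a else b) ≡ b
if-does-no {a = a} {b} d ¬x = cong (if_then a else b) (dec-false d ¬x)

_≟HE_ : ∀ {n} (h h' : HalfEdge n) → Dec (h ≡ h')
_≟HE_ = Data.Product.Properties.≡-dec Fin._≟_ Boolₚ._≟_

-- Trivial loops

module Loop (G : RibbonGraph) (e : Edge G) where
  open RibbonGraphFacts G

  record LoopAt : Set where
    field
      v      : Vx
      lo hi  : Fin (length (rot P v))
      lo<hi  : toℕ lo < toℕ hi
      βlo    : Bool
      lookup-lo : lookup (rot P v) lo ≡ (e , βlo)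
      lookup-hi : lookup (rot P v) hi ≡ (e , not βlo)

  loopAt : IsLoop G e → LoopAt
  loopAt (v , (i , lᶠ) , (j , lᵗ)) with ℕₚ.<-cmp (toℕ i) (toℕ j)
  ... | tri< i<j _ _ = record { v = v ; lo = i ; hi = j ; lo<hi = i<j ; βlo = false ; lookup-lo = lᶠ ; lookup-hi = lᵗ }
  ... | tri> _ _ j<i = record { v = v ; lo = j ; hi = i ; lo<hi = j<i ; βlo = true ; lookup-lo = lᵗ ; lookup-hi = lᶠ }
  ... | tri≈ _ i≡j _ = ⊥-elim (Boolₚ.not-¬ refl (cong proj₂ (trans (sym lᶠ) (trans (cong (lookup (rot P v)) (Finₚ.toℕ-injective i≡j)) lᵗ))))

  -- The graph G split along the loop e: the vertex v is replaced by two vertices, zero carrying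
  -- the half-edges strictly inside the loop and suc v carrying those outside; every other vertex
  -- w becomes suc w, and e itself is dropped.
  module Split (L : LoopAt) where
    open LoopAt L public

    Inside : HE → Set
    Inside h = Σ (Fin (length (rot P v))) λ m → lookup (rot P v) m ≡ h × toℕ lo < toℕ m × toℕ m < toℕ hi

    inside? : ∀ h → Dec (Inside h)
    inside? h = Finₚ.any? (λ m → (lookup (rot P v) m ≟HE h) ×-dec ((toℕ lo ℕₚ.<? toℕ m) ×-dec (toℕ m ℕₚ.<? toℕ hi)))

    site : HE → Fin (suc (nV P))
    site h = if does (inside? h) then zero else suc (home h)

    SplitAdj : Fin (suc (nV P)) → Fin (suc (nV P)) → Set
    SplitAdj x y = Σ E λ g → g ≢ e × site (g , false) ≡ x × site (g , true) ≡ y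

    e-home : ∀ {w m β} → lookup (rot P w) m ≡ (e , β) → w ≡ v
    e-home {w} {m} {β} lk with β Boolₚ.≟ βlo
    ... | yes refl = proj₁ (occUniq G w v m lo (trans lk (sym lookup-lo)))
    ... | no β≢βlo = proj₁ (occUniq G w v m hi (trans lk (trans (cong (e ,_) (Boolₚ.¬-not β≢βlo)) (sym lookup-hi))))

    e-at-v : ∀ (m : Fin (length (rot P v))) → proj₁ (lookup (rot P v) m) ≡ e → toℕ m ≡ toℕ lo ⊎ toℕ m ≡ toℕ hi
    e-at-v m eq with proj₂ (lookup (rot P v) m) Boolₚ.≟ βlo
    ... | yes b = inj₁ (proj₂ (occUniq G v v m lo (trans (cong₂ _,_ eq b) (sym lookup-lo))))
    ... | no nb = inj₂ (proj₂ (occUniq G v v m hi (trans (cong₂ _,_ eq (Boolₚ.¬-not nb)) (sym lookup-hi))))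

    site-away : ∀ {h w m} → lookup (rot P w) m ≡ h → w ≢ v → site h ≡ suc w
    site-away {h} {w} {m} lk w≢v with inside? h
    ... | yes (m' , lk' , _) = ⊥-elim (w≢v (proj₁ (occUniq G w v m m' (trans lk (sym lk')))))
    ... | no _ = cong suc (sym (home-unique lk))

    module KeptLoop (p : Partition G) (kept-e : isBar (p e) ≡ false) where
      Q : PreRibbon
      Q = ofPartition p

      keep : HE → Bool
      keep = kept (isBar ∘ p)
      open Boundary Q

      private
        kept-at : ∀ {m β} → lookup (rot P v) m ≡ (e , β) → keep (lookup (rot P v) m) ≡ true
        kept-at lk = trans (cong keep lk) (cong not kept-e)

      loQ : Pos v
      loQ = proj₁ (keptPos-surjective keep (rot P v) lo (kept-at lookup-lo))
      hiQ : Pos v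
      hiQ = proj₁ (keptPos-surjective keep (rot P v) hi (kept-at lookup-hi))
      keptPos-loQ : keptPos keep (rot P v) loQ ≡ lo
      keptPos-loQ = proj₂ (keptPos-surjective keep (rot P v) lo (kept-at lookup-lo))
      keptPos-hiQ : keptPos keep (rot P v) hiQ ≡ hi
      keptPos-hiQ = proj₂ (keptPos-surjective keep (rot P v) hi (kept-at lookup-hi))
      lookup-loQ : lookup (rot Q v) loQ ≡ (e , βlo)
      lookup-loQ = trans (sym (lookup-keptPos keep (rot P v) loQ)) (trans (cong (lookup (rot P v)) keptPos-loQ) lookup-lo)
      lookup-hiQ : lookup (rot Q v) hiQ ≡ (e , not βlo)
      lookup-hiQ = trans (sym (lookup-keptPos keep (rot P v) hiQ)) (trans (cong (lookup (rot P v)) keptPos-hiQ) lookup-hi)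
      loQ<hiQ : toℕ loQ < toℕ hiQ
      loQ<hiQ = keptPos-mono⁻ keep (rot P v) loQ hiQ (subst₂ (λ a b → toℕ a < toℕ b) (sym keptPos-loQ) (sym keptPos-hiQ) lo<hi)

      strictly-inside⇔Inside : ∀ q → (toℕ loQ < toℕ q × toℕ q < toℕ hiQ) ⇔ Inside (lookup (rot Q v) q)
      strictly-inside⇔Inside q = mk⇔
        (λ (a , b) → k , lk , subst (λ z → toℕ z < toℕ k) keptPos-loQ (keptPos-mono keep (rot P v) loQ q a)
                            , subst (λ z → toℕ k < toℕ z) keptPos-hiQ (keptPos-mono keep (rot P v) q hiQ b))
        (λ (m , lkm , a , b) → let m≡k = proj₂ (occUniq G v v m k (trans lkm (sym lk))) in
            keptPos-mono⁻ keep (rot P v) loQ q (subst₂ _<_ (cong toℕ (sym keptPos-loQ)) m≡k a)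
          , keptPos-mono⁻ keep (rot P v) q hiQ (subst₂ _<_ m≡k (cong toℕ (sym keptPos-hiQ)) b))
        where
        k = keptPos keep (rot P v) q
        lk : lookup (rot P v) k ≡ lookup (rot Q v) q
        lk = lookup-keptPos keep (rot P v) q

      not-inside⇒outside : ∀ q → edgeAt v q ≢ e → ¬ Inside (lookup (rot Q v) q) → toℕ q < toℕ loQ ⊎ toℕ hiQ < toℕ q
      not-inside⇒outside q not-e outside with ℕₚ.<-cmp (toℕ q) (toℕ loQ) | ℕₚ.<-cmp (toℕ q) (toℕ hiQ)
      ... | tri< q<lo _ _ | _ = inj₁ q<lo
      ... | tri≈ _ q≡lo _ | _ = ⊥-elim (not-e (trans (cong (proj₁ ∘ lookup (rot Q v)) (Finₚ.toℕ-injective q≡lo)) (cong proj₁ lookup-loQ)))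
      ... | tri> _ _ _ | tri≈ _ q≡hi _ = ⊥-elim (not-e (trans (cong (proj₁ ∘ lookup (rot Q v)) (Finₚ.toℕ-injective q≡hi)) (cong proj₁ lookup-hiQ)))
      ... | tri> _ _ lo<q | tri< q<hi _ _ = ⊥-elim (outside (Function.Bundles.Equivalence.to (strictly-inside⇔Inside q) (lo<q , q<hi)))
      ... | tri> _ _ _ | tri> _ _ hi<q = inj₂ hi<q

    -- When e is kept untwisted, every boundary arc of G^{τ(Z)} \ Y stays within one vertex of the
    -- split graph (up to split-connectivity), because the corners inside the loop are only
    -- joined to corners inside it.
    module Untwisted (p : Partition G) (kept-e : isBar (p e) ≡ false) (untwisted : tw P e xor isHat (p e) ≡ false) where
      open KeptLoop p kept-e
      open Boundary Q

      InsideCorner : Pos v → Bool → Set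
      InsideCorner q true = toℕ loQ ≤ toℕ q × toℕ q < toℕ hiQ
      InsideCorner q false = toℕ loQ < toℕ q × toℕ q ≤ toℕ hiQ

      insideCorner? : ∀ q s → Dec (InsideCorner q s)
      insideCorner? q true = (toℕ loQ ℕₚ.≤? toℕ q) ×-dec (toℕ q ℕₚ.<? toℕ hiQ)
      insideCorner? q false = (toℕ loQ ℕₚ.<? toℕ q) ×-dec (toℕ q ℕₚ.≤? toℕ hiQ)

      siteAtV : Pos v → Bool → Fin (suc (nV P))
      siteAtV q s = if does (insideCorner? q s) then zero else suc v

      cornerSite : BPoint Q → Fin (suc (nV P))
      cornerSite (inj₁ (w , q , s)) with w Fin.≟ v
      ... | yes refl = siteAtV q s
      ... | no _ = suc w
      cornerSite (inj₂ (w , _)) = suc w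

      cornerSite-v : ∀ q s → cornerSite (corner v q s) ≡ siteAtV q s
      cornerSite-v q s with v Fin.≟ v
      ... | yes refl = refl
      ... | no v≢v = ⊥-elim (v≢v refl)

      cornerSite-at : ∀ w (q : Pos w) (t : Pos v) s → lookup (rot Q w) q ≡ lookup (rot Q v) t → cornerSite (corner w q s) ≡ siteAtV t s
      cornerSite-at w q t s lk with Sub-occUniq (isHat ∘ p) (isBar ∘ p) w v q t lk
      ... | refl , q≡t = trans (cornerSite-v q s) (cong (λ z → siteAtV z s) (Finₚ.toℕ-injective q≡t))

      InsideCorner⇔strictly : ∀ q s → toℕ q ≢ toℕ loQ → toℕ q ≢ toℕ hiQ →
                              InsideCorner q s ⇔ (toℕ loQ < toℕ q × toℕ q < toℕ hiQ)
      InsideCorner⇔strictly q true q≢lo _ = mk⇔ (λ (a , b) → ℕₚ.≤∧≢⇒< a (q≢lo ∘ sym) , b) (λ (a , b) → ℕₚ.<⇒≤ a , b)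
      InsideCorner⇔strictly q false _ q≢hi = mk⇔ (λ (a , b) → a , ℕₚ.≤∧≢⇒< b q≢hi) (λ (a , b) → a , ℕₚ.<⇒≤ b)

      cornerSite≡site : ∀ w q s → edgeAt w q ≢ e → cornerSite (corner w q s) ≡ site (lookup (rot Q w) q)
      cornerSite≡site w q s not-e with w Fin.≟ v
      ... | no w≢v = sym (site-away (lookup-keptPos keep (rot P w) q) w≢v)
      ... | yes refl = cong₂ (if_then zero else_)
                             (does-⇔ (insideCorner? q s) (inside? _) (to ⇔₂ ∘ to ⇔₁) (from ⇔₁ ∘ from ⇔₂))
                             (cong suc (home-unique (lookup-keptPos keep (rot P v) q)))
        where
        open Function.Bundles.Equivalence
        not-end : ∀ {end β} → lookup (rot Q v) end ≡ (e , β) → toℕ q ≢ toℕ end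
        not-end lk q≡end = not-e (trans (cong (proj₁ ∘ lookup (rot Q v)) (Finₚ.toℕ-injective q≡end)) (cong proj₁ lk))
        ⇔₁ : InsideCorner q s ⇔ (toℕ loQ < toℕ q × toℕ q < toℕ hiQ)
        ⇔₁ = InsideCorner⇔strictly q s (not-end lookup-loQ) (not-end lookup-hiQ)
        ⇔₂ : (toℕ loQ < toℕ q × toℕ q < toℕ hiQ) ⇔ Inside (lookup (rot Q v) q)
        ⇔₂ = strictly-inside⇔Inside q

      vertexArc-inside : ∀ q → InsideCorner q true ⇔ InsideCorner (next q) false
      vertexArc-inside q with ℕₚ.m≤n⇒m<n∨m≡n (Finₚ.toℕ<n q)
      ... | inj₁ q<last = mk⇔
        (λ (a , b) → subst (λ z → toℕ loQ < z × z ≤ toℕ hiQ) (sym (toℕ-next-< q q<last)) (s≤s a , b))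
        (λ ins → let (a , b) = subst (λ z → toℕ loQ < z × z ≤ toℕ hiQ) (toℕ-next-< q q<last) ins in ℕₚ.≤-pred a , b)
      ... | inj₂ q≡last = mk⇔
        (λ (_ , q<hi) → ⊥-elim (ℕₚ.<-irrefl refl (ℕₚ.<-≤-trans q<hi (ℕₚ.≤-pred (subst (toℕ hiQ <_) (sym q≡last) (Finₚ.toℕ<n hiQ))))))
        (λ (lo<0 , _) → ⊥-elim (ℕₚ.n≮0 (subst (toℕ loQ <_) (toℕ-next-last q q≡last) lo<0)))

      ends-inside : ∀ s → InsideCorner loQ s ⇔ InsideCorner hiQ (not s)
      ends-inside true = mk⇔ (λ (_ , lo<hi) → lo<hi , ℕₚ.≤-refl) (λ _ → ℕₚ.≤-refl , loQ<hiQ)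
      ends-inside false = mk⇔ (λ (lo<lo , _) → ⊥-elim (ℕₚ.<-irrefl refl lo<lo)) (λ (_ , hi<hi) → ⊥-elim (ℕₚ.<-irrefl refl hi<hi))

      edgeArc-e : ∀ {w q w' q' s} → lookup (rot Q w) q ≡ (e , false) → lookup (rot Q w') q' ≡ (e , true) →
                  cornerSite (corner w q s) ≡ cornerSite (corner w' q' (not s))
      edgeArc-e {w} {q} {w'} {q'} {s} l₁ l₂ = by-βlo βlo lookup-loQ lookup-hiQ
        where
        open Function.Bundles.Equivalence
        same : ∀ s → siteAtV loQ s ≡ siteAtV hiQ (not s)
        same s = cong (if_then zero else suc v) (does-⇔ (insideCorner? loQ s) (insideCorner? hiQ (not s)) (to (ends-inside s)) (from (ends-inside s)))
        by-βlo : ∀ β → lookup (rot Q v) loQ ≡ (e , β) → lookup (rot Q v) hiQ ≡ (e , not β) →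
                 cornerSite (corner w q s) ≡ cornerSite (corner w' q' (not s))
        by-βlo false a b = trans (cornerSite-at w q loQ s (trans l₁ (sym a)))
                                 (trans (same s) (sym (cornerSite-at w' q' hiQ (not s) (trans l₂ (sym b)))))
        by-βlo true a b = trans (cornerSite-at w q hiQ s (trans l₁ (sym b)))
                                (trans (subst (λ t → siteAtV hiQ t ≡ siteAtV loQ (not s)) (Boolₚ.not-involutive s) (sym (same (not s))))
                                       (sym (cornerSite-at w' q' loQ (not s) (trans l₂ (sym a)))))

      BRel⇒SplitAdj : ∀ {x y} → BRel Q x y → Conn SplitAdj (cornerSite x) (cornerSite y)
      BRel⇒SplitAdj (arc (vertexArc w q)) with w Fin.≟ v
      ... | no _ = ε
      ... | yes refl = ≡⇒Conn (cong (if_then zero else suc v)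
                         (does-⇔ (insideCorner? q true) (insideCorner? (next q) false) (to (vertexArc-inside q)) (from (vertexArc-inside q))))
        where open Function.Bundles.Equivalence
      BRel⇒SplitAdj (arc (edgeArc w q w' q' g s l₁ l₂)) with g Fin.≟ e
      ... | no g≢e = Conn-return (g , g≢e , sym (trans (cornerSite≡site w q s (g≢e ∘ trans (sym (cong proj₁ l₁)))) (cong site l₁))
                                           , sym (trans (cornerSite≡site w' q' _ (g≢e ∘ trans (sym (cong proj₁ l₂)))) (cong site l₂)))
      ... | yes refl = ≡⇒Conn (trans (edgeArc-e l₁ l₂) (cong (λ t → cornerSite (corner w' q' (if t then s else not s))) (sym untwisted)))

      -- The two corners at the end loQ of e lie on opposite sides of the loop, so unless the
      -- split graph joins the two sides, b(Q) exceeds k(G).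
      split-disconnected⇒b≢k : ∀ n → BoundaryCount Q n → ComponentCount P n → ¬ Conn SplitAdj zero (suc v) → ⊥
      split-disconnected⇒b≢k n BC CC separated = ℕₚ.<-irrefl refl
        (classes-< BC CC vertexOf (Conn-mono (Conn-return ∘ Adj-Sub⇒Adj (isHat ∘ p) (isBar ∘ p)) ∘ BRel⇒Adj)
                   (λ w → pointAt w , ≡⇒Conn (vertexOf-pointAt w)) (corner v loQ true) (corner v loQ false) disconnected ε)
        where
        inside-lo : cornerSite (corner v loQ true) ≡ zero
        inside-lo = trans (cornerSite-v loQ true) (if-does-yes (insideCorner? loQ true) (ℕₚ.≤-refl , loQ<hiQ))
        outside-lo : cornerSite (corner v loQ false) ≡ suc v
        outside-lo = trans (cornerSite-v loQ false) (if-does-no (insideCorner? loQ false) (λ (lo<lo , _) → ℕₚ.<-irrefl refl lo<lo))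
        disconnected : ¬ Conn (BRel Q) (corner v loQ true) (corner v loQ false)
        disconnected c = separated (subst₂ (Conn SplitAdj) inside-lo outside-lo (Conn-map cornerSite BRel⇒SplitAdj c))

inject₁≡suc∧suc≡inject₁⇒⊥ : ∀ {n} (i j : Fin n) → inject₁ i ≡ suc j → suc i ≡ inject₁ j → ⊥
inject₁≡suc∧suc≡inject₁⇒⊥ i j e₁ e₂ = ℕₚ.<-asym (ℕₚ.≤-reflexive (sym (trans (sym (Finₚ.toℕ-inject₁ i)) (cong toℕ e₁))))
                              (ℕₚ.≤-reflexive (trans (cong toℕ e₂) (Finₚ.toℕ-inject₁ j)))

module Walks {N : ℕ} {E : Set} (ok : E → Set) (src tgt : E → Fin N) where

  EdgeAdj : Fin N → Fin N → Set
  EdgeAdj x y = Σ E λ g → ok g × src g ≡ x × tgt g ≡ y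

  Joined : E → Fin N → Fin N → Set
  Joined g x y = (src g ≡ x × tgt g ≡ y) ⊎ (src g ≡ y × tgt g ≡ x)

  Step : Fin N → Fin N → Set
  Step x y = Σ E λ g → ok g × Joined g x y

  data Path : Fin N → Fin N → Set where
    []  : ∀ {x} → Path x x
    _∷_ : ∀ {x y z} → Step x y → Path y z → Path x z

  steps : ∀ {x z} → Path x z → ℕ
  steps [] = 0
  steps (_ ∷ π) = suc (steps π)

  vertex : ∀ {x z} (π : Path x z) → Fin (suc (steps π)) → Fin N
  vertex {x} [] _ = x
  vertex {x} (_ ∷ π) zero = x
  vertex (_ ∷ π) (suc i) = vertex π i

  edge : ∀ {x z} (π : Path x z) → Fin (steps π) → E
  edge (r ∷ π) zero = proj₁ r
  edge (r ∷ π) (suc i) = edge π i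

  edge-ok : ∀ {x z} (π : Path x z) i → ok (edge π i)
  edge-ok (r ∷ π) zero = proj₁ (proj₂ r)
  edge-ok (r ∷ π) (suc i) = edge-ok π i

  edge-joins : ∀ {x z} (π : Path x z) i → Joined (edge π i) (vertex π (inject₁ i)) (vertex π (suc i))
  edge-joins (r ∷ []) zero = proj₂ (proj₂ r)
  edge-joins (r ∷ (_ ∷ _)) zero = proj₂ (proj₂ r)
  edge-joins (r ∷ π) (suc i) = edge-joins π i

  vertex-first : ∀ {x z} (π : Path x z) → vertex π zero ≡ x
  vertex-first [] = refl
  vertex-first (r ∷ π) = refl

  vertex-last : ∀ {x z} (π : Path x z) → vertex π (fromℕ (steps π)) ≡ z
  vertex-last [] = refl
  vertex-last (r ∷ π) = vertex-last π

  first-step : ∀ {x z} (π : Path x z) → x ≢ z → Σ (Fin (steps π)) λ i → toℕ i ≡ 0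
  first-step [] x≢z = ⊥-elim (x≢z refl)
  first-step (r ∷ π) _ = zero , refl

  last-step : ∀ {x z} (π : Path x z) → x ≢ z → Σ (Fin (steps π)) λ i → suc (toℕ i) ≡ steps π
  last-step [] x≢z = ⊥-elim (x≢z refl)
  last-step (r ∷ π) _ = fromℕ (steps π) , cong suc (Finₚ.toℕ-fromℕ (steps π))

  OnPath : ∀ {y z} → Fin N → Path y z → Set
  OnPath x π = Σ (Fin (suc (steps π))) λ i → vertex π i ≡ x

  data Simple : ∀ {x z} → Path x z → Set where
    []  : ∀ {x} → Simple ([] {x})
    _∷_ : ∀ {x y z} {r : Step x y} {π : Path y z} → ¬ OnPath x π → Simple π → Simple (r ∷ π)

  suffix : ∀ {x y z} (π : Path y z) → Simple π → OnPath x π → Σ (Path x z) Simple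
  suffix [] σ (_ , refl) = [] , []
  suffix (r ∷ π) σ (zero , refl) = r ∷ π , σ
  suffix (r ∷ π) (_ ∷ σ) (suc i , eq) = suffix π σ (i , eq)

  loop-erase : ∀ {x z} → Conn EdgeAdj x z → Σ (Path x z) Simple
  loop-erase ε = [] , []
  loop-erase {x} (r ◅ c) with loop-erase c
  ... | π , σ with Finₚ.any? (λ i → vertex π i Fin.≟ x)
  ...   | yes on = suffix π σ on
  ...   | no off = toStep r ∷ π , off ∷ σ
    where
    toStep : ∀ {x y} → EdgeAdj x y ⊎ EdgeAdj y x → Step x y
    toStep (inj₁ (g , o , a , b)) = g , o , inj₁ (a , b)
    toStep (inj₂ (g , o , a , b)) = g , o , inj₂ (a , b)

  vertex-injective : ∀ {x z} (π : Path x z) → Simple π → ∀ i j → vertex π i ≡ vertex π j → i ≡ j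
  vertex-injective [] _ zero zero _ = refl
  vertex-injective (r ∷ π) _ zero zero _ = refl
  vertex-injective (r ∷ π) (off ∷ _) zero (suc j) eq = ⊥-elim (off (j , sym eq))
  vertex-injective (r ∷ π) (off ∷ _) (suc i) zero eq = ⊥-elim (off (i , eq))
  vertex-injective (r ∷ π) (_ ∷ σ) (suc i) (suc j) eq = cong suc (vertex-injective π σ i j eq)

  edge-injective : ∀ {x z} (π : Path x z) → Simple π → ∀ i j → edge π i ≡ edge π j → i ≡ j
  edge-injective π σ i j eq with edge-joins π i | edge-joins π j
  ... | inj₁ (a , b) | inj₁ (c , d) = Finₚ.inject₁-injective (vertex-injective π σ _ _ (trans (sym a) (trans (cong src eq) c)))
  ... | inj₂ (a , b) | inj₂ (c , d) = Finₚ.inject₁-injective (vertex-injective π σ _ _ (trans (sym b) (trans (cong tgt eq) d)))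
  ... | inj₁ (a , b) | inj₂ (c , d) = ⊥-elim (inject₁≡suc∧suc≡inject₁⇒⊥ i j (vertex-injective π σ _ _ (trans (sym a) (trans (cong src eq) c)))
                                                          (vertex-injective π σ _ _ (trans (sym b) (trans (cong tgt eq) d))))
  ... | inj₂ (a , b) | inj₁ (c , d) = ⊥-elim (inject₁≡suc∧suc≡inject₁⇒⊥ j i (vertex-injective π σ _ _ (trans (sym c) (trans (cong src (sym eq)) a)))
                                                          (vertex-injective π σ _ _ (trans (sym d) (trans (cong tgt (sym eq)) b))))

module SplitCycles (G : RibbonGraph) (e : Edge G) (L : Loop.LoopAt G e) where
  open RibbonGraphFacts G
  open Loop G e
  open Split L public
  open Walks {N = suc (nV P)} {E = E} (λ g → g ≢ e) (λ g → site (g , false)) (λ g → site (g , true)) public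

  unsplit : Fin (suc (nV P)) → Vx
  unsplit zero = v
  unsplit (suc w) = w

  unsplit-injective : ∀ a b → a ≢ suc v → b ≢ suc v → unsplit a ≡ unsplit b → a ≡ b
  unsplit-injective zero zero _ _ _ = refl
  unsplit-injective zero (suc w) _ b≢ eq = ⊥-elim (b≢ (cong suc (sym eq)))
  unsplit-injective (suc w) zero a≢ _ eq = ⊥-elim (a≢ (cong suc eq))
  unsplit-injective (suc w) (suc w') _ _ eq = cong suc eq

  site≡zero⇒Inside : ∀ h → site h ≡ zero → Inside h
  site≡zero⇒Inside h eq with inside? h
  ... | yes ins = ins

  site≡v⇒outside : ∀ h → site h ≡ suc v → ¬ Inside h × home h ≡ v
  site≡v⇒outside h eq with inside? h
  ... | no out = out , Finₚ.suc-injective eq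

  pos-at-site : ∀ h → Σ (Fin (length (rot P (unsplit (site h))))) λ m → lookup (rot P (unsplit (site h))) m ≡ h
  pos-at-site h with inside? h
  ... | yes (m , lk , _) = m , lk
  ... | no _ = homePos h , lookup-homePos h

  home≡unsplit-site : ∀ h → home h ≡ unsplit (site h)
  home≡unsplit-site h = sym (home-unique (proj₂ (pos-at-site h)))

  incident-at-site : ∀ g b x → site (g , b) ≡ x → Incident G g b (unsplit x)
  incident-at-site g b x refl = pos-at-site (g , b)

  outside-position : ∀ h → proj₁ h ≢ e → site h ≡ suc v →
                     ∃ λ m → (toℕ m < toℕ lo ⊎ toℕ m > toℕ hi) × proj₁ (lookup (rot P v) m) ≡ proj₁ h
  outside-position h not-e eq with site≡v⇒outside h eq
  ... | out , refl with ℕₚ.<-cmp (toℕ (homePos h)) (toℕ lo) | ℕₚ.<-cmp (toℕ (homePos h)) (toℕ hi)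
  ...   | tri< m<lo _ _ | _ = homePos h , inj₁ m<lo , cong proj₁ (lookup-homePos h)
  ...   | tri≈ _ m≡lo _ | _ = ⊥-elim (not-e (trans (sym (cong proj₁ (lookup-homePos h)))
                                (trans (cong (proj₁ ∘ lookup (rot P v)) (Finₚ.toℕ-injective m≡lo)) (cong proj₁ lookup-lo))))
  ...   | tri> _ _ _ | tri≈ _ m≡hi _ = ⊥-elim (not-e (trans (sym (cong proj₁ (lookup-homePos h)))
                                (trans (cong (proj₁ ∘ lookup (rot P v)) (Finₚ.toℕ-injective m≡hi)) (cong proj₁ lookup-hi))))
  ...   | tri> _ _ lo<m | tri< m<hi _ _ = ⊥-elim (out (homePos h , lookup-homePos h , lo<m , m<hi))
  ...   | tri> _ _ _ | tri> _ _ hi<m = homePos h , inj₂ hi<m , cong proj₁ (lookup-homePos h)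

  oriented-ends : ∀ {g x y} → Joined g x y → Σ Bool λ β → site (g , β) ≡ x × site (g , not β) ≡ y
  oriented-ends (inj₁ (a , b)) = false , a , b
  oriented-ends (inj₂ (a , b)) = true , b , a

  -- A simple path from the inside to the outside of the loop closes up, through v, to a cycle
  -- whose first edge leaves v inside the loop and whose last edge returns outside it.
  simplePath⇒interlaced : (π : Path zero (suc v)) → Simple π → Σ (Cycle G) (Interlaced G e)
  simplePath⇒interlaced π@(r ∷ π') σ = C , v , lo , hi , lo<hi , cong proj₁ lookup-lo , cong proj₁ lookup-hi , first-inside , last-outside
    where
    vs′ : Fin (steps π) → Vx
    vs′ i = unsplit (vertex π (inject₁ i))
    not-last : ∀ i → vertex π (inject₁ i) ≢ suc v
    not-last i eq = Finₚ.fromℕ≢inject₁ (sym (vertex-injective π σ (inject₁ i) (fromℕ (steps π)) (trans eq (sym (vertex-last π)))))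
    vs′-injective : ∀ i j → vs′ i ≡ vs′ j → i ≡ j
    vs′-injective i j eq = Finₚ.inject₁-injective (vertex-injective π σ _ _ (unsplit-injective _ _ (not-last i) (not-last j) eq))
    vertex-suc : ∀ i → unsplit (vertex π (suc i)) ≡ vs′ (next i)
    vertex-suc i = by-position (ℕₚ.m≤n⇒m<n∨m≡n (Finₚ.toℕ<n i))
      where
      by-position : suc (toℕ i) < steps π ⊎ suc (toℕ i) ≡ steps π → unsplit (vertex π (suc i)) ≡ vs′ (next i)
      by-position (inj₁ lt) = cong (unsplit ∘ vertex π) (Finₚ.toℕ-injective (trans (sym (toℕ-next-< i lt)) (sym (Finₚ.toℕ-inject₁ (next i)))))
      by-position (inj₂ eq) = trans (cong unsplit (trans (cong (vertex π) (Finₚ.toℕ-injective (trans eq (sym (Finₚ.toℕ-fromℕ (steps π)))))) (vertex-last π)))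
                                    (cong (unsplit ∘ vertex π ∘ inject₁) (sym (Finₚ.toℕ-injective {j = zero} (toℕ-next-last i eq))))
    joins′ : ∀ i → Joins G (edge π i) (vs′ i) (vs′ (next i))
    joins′ i = by-ends (edge-joins π i)
      where
      by-ends : Joined (edge π i) (vertex π (inject₁ i)) (vertex π (suc i)) → Joins G (edge π i) (vs′ i) (vs′ (next i))
      by-ends (inj₁ (a , b)) = inj₁ (incident-at-site _ false _ a , subst (Incident G (edge π i) true) (vertex-suc i) (incident-at-site _ true _ b))
      by-ends (inj₂ (a , b)) = inj₂ (subst (Incident G (edge π i) false) (vertex-suc i) (incident-at-site _ false _ a) , incident-at-site _ true _ b)
    C : Cycle G
    C = record { len = steps π' ; es = edge π ; vs = vs′ ; esInj = edge-injective π σ ; vsInj = vs′-injective ; joins = joins′ }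
    first-inside : ∃ λ m → toℕ lo < toℕ m × toℕ m < toℕ hi × InCycle {G} (proj₁ (lookup (rot P v) m)) C
    first-inside = let (β , at-zero , _) = oriented-ends (edge-joins π zero) ; (m , lk , x , y) = site≡zero⇒Inside _ at-zero in
                   m , x , y , zero , sym (cong proj₁ lk)
    last : Fin (steps π)
    last = fromℕ (steps π')
    last-outside : ∃ λ m → (toℕ m < toℕ lo ⊎ toℕ m > toℕ hi) × InCycle {G} (proj₁ (lookup (rot P v) m)) C
    last-outside = let (β , _ , at-top) = oriented-ends (edge-joins π last)
                       (m , o , q) = outside-position _ (edge-ok π last) (trans at-top (vertex-last π)) in
                   m , o , last , sym q

  split-connected⇒interlaced : Conn EdgeAdj zero (suc v) → Σ (Cycle G) (Interlaced G e)
  split-connected⇒interlaced c = let (π , σ) = loop-erase c in simplePath⇒interlaced π σ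

  module AroundCycle (C : Cycle G) where
    private
      n : ℕ
      n = len C

    orientation : ∀ t → Σ Bool λ β → Incident G (es C t) β (vs C t) × Incident G (es C t) (not β) (vs C (next t))
    orientation t with joins C t
    ... | inj₁ (x , y) = false , x , y
    ... | inj₂ (x , y) = true , y , x

    tailHE headHE : Fin (suc n) → HE
    tailHE t = es C t , proj₁ (orientation t)
    headHE t = es C t , not (proj₁ (orientation t))

    tail-home : ∀ t → home (tailHE t) ≡ vs C t
    tail-home t = sym (home-unique (proj₂ (proj₁ (proj₂ (orientation t)))))

    head-home : ∀ t → home (headHE t) ≡ vs C (next t)
    head-home t = sym (home-unique (proj₂ (proj₂ (proj₂ (orientation t)))))

    half-edge-at-v : ∀ t β (m : Fin (length (rot P v))) → lookup (rot P v) m ≡ (es C t , β) →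
                     (es C t , β) ≡ tailHE t × vs C t ≡ v ⊎ (es C t , β) ≡ headHE t × vs C (next t) ≡ v
    half-edge-at-v t β m lk with β Boolₚ.≟ proj₁ (orientation t)
    ... | yes refl = inj₁ (refl , trans (sym (tail-home t)) (sym (home-unique lk)))
    ... | no β≢ = inj₂ (cong (es C t ,_) (Boolₚ.¬-not β≢)
                       , trans (sym (head-home t)) (trans (cong (λ b → home (es C t , b)) (sym (Boolₚ.¬-not β≢))) (sym (home-unique lk))))

    junction : ∀ t → vs C (next t) ≢ v → site (headHE t) ≡ site (tailHE (next t))
    junction t away = trans (site-away (proj₂ (proj₂ (proj₂ (orientation t)))) away)
                            (sym (site-away (proj₂ (proj₁ (proj₂ (orientation (next t))))) away))

    through-e⇒single : ∀ t → es C t ≡ e → ∀ t' → t' ≡ t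
    through-e⇒single t eq t' = Finₚ.toℕ-injective (trans (≡0 t') (sym (≡0 t)))
      where
      t≡next-t : t ≡ next t
      t≡next-t = vsInj C t (next t) (trans (trans (sym (tail-home t)) (e-home′ (tailHE t) eq))
                                           (sym (trans (sym (head-home t)) (e-home′ (headHE t) eq))))
        where
        e-home′ : ∀ h → proj₁ h ≡ e → home h ≡ v
        e-home′ (_ , β) refl = e-home (lookup-homePos (e , β))
      n≡0 : n ≡ 0
      n≡0 with ℕₚ.m≤n⇒m<n∨m≡n (Finₚ.toℕ<n t)
      ... | inj₁ lt = ⊥-elim (ℕₚ.1+n≢n (sym (trans (cong toℕ t≡next-t) (toℕ-next-< t lt))))
      ... | inj₂ eq′ = ℕₚ.suc-injective (trans (sym eq′) (cong suc (trans (cong toℕ t≡next-t) (toℕ-next-last t eq′))))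
      ≡0 : ∀ (x : Fin (suc n)) → toℕ x ≡ 0
      ≡0 x = ℕₚ.n≤0⇒n≡0 (subst (toℕ x ≤_) n≡0 (ℕₚ.≤-pred (Finₚ.toℕ<n x)))

    module AvoidingE (avoid-e : ∀ t → es C t ≢ e) where

      along : ∀ t → Conn EdgeAdj (site (tailHE t)) (site (headHE t))
      along t with proj₁ (orientation t)
      ... | false = Conn-return (es C t , avoid-e t , refl , refl)
      ... | true = Conn-return˘ (es C t , avoid-e t , refl , refl)

      walk : ∀ d i j → toℕ j ≡ toℕ i + d → (∀ k → toℕ i < toℕ k → toℕ k ≤ toℕ j → vs C k ≢ v) →
             Conn EdgeAdj (site (tailHE i)) (site (headHE j))
      walk zero i j j≡i _ = subst (λ z → Conn EdgeAdj (site (tailHE i)) (site (headHE z)))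
                                  (Finₚ.toℕ-injective (sym (trans j≡i (ℕₚ.+-identityʳ _)))) (along i)
      walk (suc d) i j j≡ away with predecessor j (trans j≡ (ℕₚ.+-suc _ d))
      ... | j' , j'≡ , refl = walk d i j' j'≡ (λ k i<k k≤j' → away k i<k (ℕₚ.<⇒≤ (ℕₚ.≤-<-trans k≤j' j'<j)))
                              ◅◅ ≡⇒Conn (junction j' (away (next j') i<j ℕₚ.≤-refl)) ◅◅ along (next j')
        where
        j≡1+i+d : toℕ (next j') ≡ suc (toℕ i + d)
        j≡1+i+d = trans j≡ (ℕₚ.+-suc _ d)
        j'<j : toℕ j' < toℕ (next j')
        j'<j = subst₂ _<_ (sym j'≡) (sym j≡1+i+d) (ℕₚ.n<1+n _)
        i<j : toℕ i < toℕ (next j')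
        i<j = subst (toℕ i <_) (sym j≡1+i+d) (s≤s (ℕₚ.m≤m+n _ d))

      around : ∀ q → vs C q ≡ v → Σ (Fin (suc n)) λ q' → next q' ≡ q × Conn EdgeAdj (site (tailHE q)) (site (headHE q'))
      around q vq with toℕ q in q≡
      ... | zero = fromℕ n , trans (next-fromℕ n) (sym (Finₚ.toℕ-injective {j = zero} q≡))
                 , walk n q (fromℕ n) (trans (Finₚ.toℕ-fromℕ n) (cong (_+ n) (sym q≡)))
                        (λ k q<k _ → away-from k (λ { refl → ℕₚ.<-irrefl refl q<k }))
        where
        away-from : ∀ k → k ≢ q → vs C k ≢ v
        away-from k k≢q vk = k≢q (vsInj C k q (trans vk (sym vq)))
      ... | suc m with predecessor q q≡
      ...   | q' , q'≡m , next-q'≡q = q' , next-q'≡q ,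
              walk (n ∸ toℕ q) q (fromℕ n) (trans (Finₚ.toℕ-fromℕ n) (sym (ℕₚ.m+[n∸m]≡n (ℕₚ.≤-pred (Finₚ.toℕ<n q)))))
                   (λ k q<k _ → away-from k (λ { refl → ℕₚ.<-irrefl refl q<k }))
              ◅◅ ≡⇒Conn (trans (junction (fromℕ n) (subst (λ z → vs C z ≢ v) (sym (next-fromℕ n)) (away-from zero zero≢q)))
                               (cong (site ∘ tailHE) (next-fromℕ n)))
              ◅◅ walk m zero q' q'≡m (λ k _ k≤q' → away-from k (λ { refl → ℕₚ.<-irrefl refl (ℕₚ.≤-<-trans k≤q' q'<q) }))
        where
        away-from : ∀ k → k ≢ q → vs C k ≢ v
        away-from k k≢q vk = k≢q (vsInj C k q (trans vk (sym vq)))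
        zero≢q : zero ≢ q
        zero≢q refl = ℕₚ.0≢1+n q≡
        q'<q : toℕ q' < toℕ q
        q'<q = subst₂ _<_ (sym q'≡m) (sym q≡) (ℕₚ.n<1+n m)

  record Crossing (C : Cycle G) : Set where
    field
      m₁ m₂ : Fin (length (rot P v))
      p₁ p₂ : Fin (suc (len C))
      on-C₁ : es C p₁ ≡ proj₁ (lookup (rot P v) m₁)
      on-C₂ : es C p₂ ≡ proj₁ (lookup (rot P v) m₂)
      inside₁ : site (lookup (rot P v) m₁) ≡ zero
      outside₂ : site (lookup (rot P v) m₂) ≡ suc v
      not-e₁ : proj₁ (lookup (rot P v) m₁) ≢ e
      distinct : lookup (rot P v) m₁ ≢ lookup (rot P v) m₂

  interlaced⇒crossing : ∀ C → Interlaced G e C → Crossing C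
  interlaced⇒crossing C (v' , i , j , i<j , ei , ej , (m₁ , i<m₁ , m₁<j , (p₁ , c₁)) , (m₂ , m₂-out , (p₂ , c₂))) =
    at-v (e-home (cong (_, proj₂ (lookup (rot P v') i)) ei)) i j i<j ei ej m₁ i<m₁ m₁<j c₁ m₂ m₂-out c₂
    where
    at-v : ∀ {v'} → v' ≡ v → ∀ (i j : Fin (length (rot P v'))) → toℕ i < toℕ j →
           proj₁ (lookup (rot P v') i) ≡ e → proj₁ (lookup (rot P v') j) ≡ e →
           ∀ m₁ → toℕ i < toℕ m₁ → toℕ m₁ < toℕ j → es C p₁ ≡ proj₁ (lookup (rot P v') m₁) →
           ∀ m₂ → (toℕ m₂ < toℕ i ⊎ toℕ m₂ > toℕ j) → es C p₂ ≡ proj₁ (lookup (rot P v') m₂) → Crossing C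
    at-v refl i j i<j ei ej m₁ i<m₁ m₁<j c₁ m₂ m₂-out c₂ = record
      { m₁ = m₁ ; m₂ = m₂ ; p₁ = p₁ ; p₂ = p₂ ; on-C₁ = c₁ ; on-C₂ = c₂
      ; inside₁ = if-does-yes (inside? _) (m₁ , refl , lo<m₁ , m₁<hi)
      ; outside₂ = trans (if-does-no (inside? _) not-inside₂) (cong suc (sym (home-unique {v} {m₂} refl)))
      ; not-e₁ = not-e₁ ; distinct = distinct }
      where
      ends : toℕ i ≡ toℕ lo × toℕ j ≡ toℕ hi
      ends with e-at-v i ei | e-at-v j ej
      ... | inj₁ i≡lo | inj₂ j≡hi = i≡lo , j≡hi
      ... | inj₁ i≡lo | inj₁ j≡lo = ⊥-elim (ℕₚ.<-irrefl (trans i≡lo (sym j≡lo)) i<j)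
      ... | inj₂ i≡hi | inj₂ j≡hi = ⊥-elim (ℕₚ.<-irrefl (trans i≡hi (sym j≡hi)) i<j)
      ... | inj₂ i≡hi | inj₁ j≡lo = ⊥-elim (ℕₚ.<-asym (subst₂ _<_ i≡hi j≡lo i<j) lo<hi)
      lo<m₁ : toℕ lo < toℕ m₁
      lo<m₁ = subst (_< toℕ m₁) (proj₁ ends) i<m₁
      m₁<hi : toℕ m₁ < toℕ hi
      m₁<hi = subst (toℕ m₁ <_) (proj₂ ends) m₁<j
      m₂-outside : toℕ m₂ < toℕ lo ⊎ toℕ m₂ > toℕ hi
      m₂-outside = Data.Sum.map (subst (toℕ m₂ <_) (proj₁ ends)) (subst (_< toℕ m₂) (proj₂ ends)) m₂-out
      not-inside₂ : ¬ Inside (lookup (rot P v) m₂)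
      not-inside₂ (m , lk , lo<m , m<hi) with proj₂ (occUniq G v v m m₂ lk) | m₂-outside
      ... | m≡m₂ | inj₁ m₂<lo = ℕₚ.<-asym (subst (toℕ lo <_) m≡m₂ lo<m) m₂<lo
      ... | m≡m₂ | inj₂ hi<m₂ = ℕₚ.<-asym (subst (_< toℕ hi) m≡m₂ m<hi) hi<m₂
      not-e₁ : proj₁ (lookup (rot P v) m₁) ≢ e
      not-e₁ eq with e-at-v m₁ eq
      ... | inj₁ m₁≡lo = ℕₚ.<-irrefl (sym m₁≡lo) lo<m₁
      ... | inj₂ m₁≡hi = ℕₚ.<-irrefl m₁≡hi m₁<hi
      distinct : lookup (rot P v) m₁ ≢ lookup (rot P v) m₂
      distinct eq with proj₂ (occUniq G v v m₁ m₂ eq) | m₂-outside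
      ... | m₁≡m₂ | inj₁ m₂<lo = ℕₚ.<-asym lo<m₁ (subst (_< toℕ lo) (sym m₁≡m₂) m₂<lo)
      ... | m₁≡m₂ | inj₂ hi<m₂ = ℕₚ.<-asym m₁<hi (subst (toℕ hi <_) (sym m₁≡m₂) hi<m₂)

  -- Going around C from the half-edge where it enters v to the one where it leaves v passes
  -- only through other vertices, so the inside and the outside of the loop get joined.
  crossing⇒split-connected : ∀ C → Crossing C → Conn EdgeAdj zero (suc v)
  crossing⇒split-connected C X = join (which p₁ on-C₁) (which p₂ on-C₂)
    where
    open Crossing X
    open AroundCycle C
    avoid-e : ∀ t → es C t ≢ e
    avoid-e t eq = not-e₁ (trans (sym on-C₁) (trans (cong (es C) (through-e⇒single t eq p₁)) eq))
    open AvoidingE avoid-e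
    as-half-edge : ∀ {m p} → es C p ≡ proj₁ (lookup (rot P v) m) → lookup (rot P v) m ≡ (es C p , proj₂ (lookup (rot P v) m))
    as-half-edge c = cong (_, _) (sym c)
    q-at-v : Σ (Fin (suc (len C))) λ q → vs C q ≡ v
    q-at-v with half-edge-at-v p₁ _ m₁ (as-half-edge on-C₁)
    ... | inj₁ (_ , vp) = p₁ , vp
    ... | inj₂ (_ , vp) = next p₁ , vp
    q : Fin (suc (len C))
    q = proj₁ q-at-v
    round : Σ (Fin (suc (len C))) λ q' → next q' ≡ q × Conn EdgeAdj (site (tailHE q)) (site (headHE q'))
    round = around q (proj₂ q-at-v)
    q' : Fin (suc (len C))
    q' = proj₁ round
    which : ∀ {m} p → es C p ≡ proj₁ (lookup (rot P v) m) → lookup (rot P v) m ≡ tailHE q ⊎ lookup (rot P v) m ≡ headHE q'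
    which {m} p c with half-edge-at-v p _ m (as-half-edge c)
    ... | inj₁ (h≡ , vp) = inj₁ (trans (as-half-edge c) (trans h≡ (cong tailHE (vsInj C p q (trans vp (sym (proj₂ q-at-v)))))))
    ... | inj₂ (h≡ , vp) = inj₂ (trans (as-half-edge c) (trans h≡ (cong headHE
                             (next-injective p q' (trans (vsInj C (next p) q (trans vp (sym (proj₂ q-at-v)))) (sym (proj₁ (proj₂ round))))))))
    h₁ h₂ : HE
    h₁ = lookup (rot P v) m₁
    h₂ = lookup (rot P v) m₂
    join : h₁ ≡ tailHE q ⊎ h₁ ≡ headHE q' → h₂ ≡ tailHE q ⊎ h₂ ≡ headHE q' → Conn EdgeAdj zero (suc v)
    join (inj₁ a) (inj₂ b) = subst₂ (Conn EdgeAdj) (trans (cong site (sym a)) inside₁) (trans (cong site (sym b)) outside₂) (proj₂ (proj₂ round))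
    join (inj₂ a) (inj₁ b) = Conn-sym (subst₂ (Conn EdgeAdj) (trans (cong site (sym b)) outside₂) (trans (cong site (sym a)) inside₁) (proj₂ (proj₂ round)))
    join (inj₁ a) (inj₁ b) = ⊥-elim (distinct (trans a (sym b)))
    join (inj₂ a) (inj₂ b) = ⊥-elim (distinct (trans a (sym b)))

  interlaced⇒split-connected : ∀ C → Interlaced G e C → Conn EdgeAdj zero (suc v)
  interlaced⇒split-connected C I = crossing⇒split-connected C (interlaced⇒crossing C I)

trivialLoop⇒singular : ∀ G e l → IsTrivialLoop G e → isBar l ≡ false → tw (pre G) e xor isHat l ≡ false → Singular G e l
trivialLoop⇒singular G e l (loop , trivial) kept untwisted (p , (n , BC , CC) , pe≡l) =
  split-disconnected⇒b≢k n BC CC (λ c → Data.Product.uncurry trivial (split-connected⇒interlaced c))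
  where
  L : Loop.LoopAt G e
  L = Loop.loopAt G e loop
  open Loop.Split G e L
  open Untwisted p (trans (cong isBar pe≡l) kept) (trans (cong ((tw (pre G) e xor_) ∘ isHat) pe≡l) untwisted)
  open SplitCycles G e L using (split-connected⇒interlaced)

module Components (G : RibbonGraph) where
  open RibbonGraphFacts G

  KeptAdj : (E → Bool) → Vx → Vx → Set
  KeptAdj Y = EdgeRel (not ∘ Y) (λ g → home (g , false)) (λ g → home (g , true))

  components : Labelling (nV P) (Adj P)
  components = labelling-⇔ (labelling-edges _ (λ _ → true) _ _)
    (λ { (g , _ , refl , refl) → Conn-return (g , (homePos (g , false) , lookup-homePos _) , (homePos (g , true) , lookup-homePos _)) })
    (λ { (g , (i , l₁) , (j , l₂)) → Conn-return (g , refl , sym (home-unique l₁) , sym (home-unique l₂)) })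

  KeptAdj⇒Adj-deleteEdges : ∀ Y {u w} → KeptAdj Y u w → Adj (deleteEdges P Y) u w
  KeptAdj⇒Adj-deleteEdges Y (g , kept-g , refl , refl) =
    g , (let (q , lk , _) = Sub-homePos (λ _ → false) Y (g , false) (Boolₚ.not-injective kept-g) in q , lk)
      , (let (q , lk , _) = Sub-homePos (λ _ → false) Y (g , true) (Boolₚ.not-injective kept-g) in q , lk)

  Adj-deleteEdges⇒KeptAdj : ∀ Y {u w} → Adj (deleteEdges P Y) u w → KeptAdj Y u w
  Adj-deleteEdges⇒KeptAdj Y {u} {w} (g , (i , l₁) , (j , l₂)) =
      g , ∈filterB⇒kept (kept Y) (rot P u) i l₁
    , sym (home-unique (proj₂ (∈filterB⇒∈ (kept Y) (rot P u) i l₁)))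
    , sym (home-unique (proj₂ (∈filterB⇒∈ (kept Y) (rot P w) j l₂)))

  components-deleteEdges : ∀ Y → Labelling (nV P) (Adj (deleteEdges P Y))
  components-deleteEdges Y = labelling-⇔ (labelling-edges _ (not ∘ Y) _ _)
    (Conn-return ∘ KeptAdj⇒Adj-deleteEdges Y) (Conn-return ∘ Adj-deleteEdges⇒KeptAdj Y)

-- Spanning trees and quasi-trees

unvisited : ∀ {n} → (Fin n → Bool) → ℕ
unvisited {zero} T = 0
unvisited {suc n} T = (if T zero then 0 else 1) + unvisited (T ∘ suc)

unvisited-insert : ∀ {n} (T : Fin n → Bool) b → T b ≡ false → unvisited (insert T b) < unvisited T
unvisited-insert {suc n} T zero Tb rewrite Tb = ℕₚ.≤-refl
unvisited-insert {suc n} T (suc b) Tb with T zero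
... | true = unvisited-insert (T ∘ suc) b Tb
... | false = s≤s (unvisited-insert (T ∘ suc) b Tb)

unvisited≡0 : ∀ {n} (T : Fin n → Bool) → unvisited T ≡ 0 → ∀ w → T w ≡ true
unvisited≡0 {suc n} T eq w with T zero in T₀
unvisited≡0 {suc n} T eq zero | true = T₀
unvisited≡0 {suc n} T eq (suc w) | true = unvisited≡0 (T ∘ suc) eq w

module SpanningForest (G : RibbonGraph) where
  open RibbonGraphFacts G

  TreeAdj : (E → Bool) → Vx → Vx → Set
  TreeAdj S u w = Σ E λ g → S g ≡ true × home (g , false) ≡ u × home (g , true) ≡ w

  TreeAdj-mono : ∀ {S S'} → (∀ g → S g ≡ true → S' g ≡ true) → ∀ {u w} → Conn (TreeAdj S) u w → Conn (TreeAdj S') u w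
  TreeAdj-mono S⊆S' = Conn-mono (λ (g , Sg , a , b) → Conn-return (g , S⊆S' g Sg , a , b))

  edge-connects : ∀ S g → S g ≡ true → ∀ γ → Conn (TreeAdj S) (home (g , γ)) (home (g , not γ))
  edge-connects S g Sg false = Conn-return (g , Sg , refl , refl)
  edge-connects S g Sg true = Conn-return˘ (g , Sg , refl , refl)

  data Grown (S₀ : E → Bool) : (E → Bool) → Set where
    start : Grown S₀ S₀
    attach : ∀ {S} → Grown S₀ S → (f : E) → S f ≡ false → (β : Bool) →
             home (f , β) ≢ home (f , not β) →
             (∀ g γ → S g ≡ true → home (g , γ) ≢ home (f , not β)) →
             Grown S₀ (insert S f)

  Grown-⊇ : ∀ {S₀ S} → Grown S₀ S → ∀ g → S₀ g ≡ true → S g ≡ true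
  Grown-⊇ start g S₀g = S₀g
  Grown-⊇ (attach {S} gr f _ _ _ _) g S₀g = insert-mono S f g (Grown-⊇ gr g S₀g)

  -- Prim's algorithm, started from a subgraph S₀ whose edges span the visited vertices T.
  module Prim (allowed : E → Bool) (S₀ : E → Bool) where

    record Invariant (S : E → Bool) (T : Vx → Bool) (cur : Vx) : Set where
      field
        grown       : Grown S₀ S
        allowed-S   : ∀ g → S g ≡ true → allowed g ≡ true
        visited-S   : ∀ g γ → S g ≡ true → T (home (g , γ)) ≡ true
        spanned     : ∀ g → allowed g ≡ true → T (home (g , false)) ≡ true → T (home (g , true)) ≡ true →
                      Conn (TreeAdj S) (home (g , false)) (home (g , true))
        frontier    : ∀ g γ → allowed g ≡ true → T (home (g , γ)) ≡ true → T (home (g , not γ)) ≡ false →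
                      Conn (TreeAdj S) (home (g , γ)) cur
        cur-visited : T cur ≡ true

    record Forest : Set where
      field
        S         : E → Bool
        grown     : Grown S₀ S
        allowed-S : ∀ g → S g ≡ true → allowed g ≡ true
        span      : ∀ g → allowed g ≡ true → Conn (TreeAdj S) (home (g , false)) (home (g , true))

    Crossing : (Vx → Bool) → E → Bool → Set
    Crossing T g γ = allowed g ≡ true × T (home (g , γ)) ≡ true × T (home (g , not γ)) ≡ false

    crossing? : ∀ T → Dec (Σ E λ g → Σ Bool λ γ → Crossing T g γ)
    crossing? T = Finₚ.any? (λ g → Dec.map′ to from (crossing-at g false ⊎-dec crossing-at g true))
      where
      crossing-at : ∀ g γ → Dec (Crossing T g γ)
      crossing-at g γ = (allowed g Boolₚ.≟ true) ×-dec ((T (home (g , γ)) Boolₚ.≟ true) ×-dec (T (home (g , not γ)) Boolₚ.≟ false))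
      to : ∀ {g} → Crossing T g false ⊎ Crossing T g true → Σ Bool (Crossing T g)
      to (inj₁ c) = false , c
      to (inj₂ c) = true , c
      from : ∀ {g} → Σ Bool (Crossing T g) → Crossing T g false ⊎ Crossing T g true
      from (false , c) = inj₁ c
      from (true , c) = inj₂ c

    module _ {S T cur} (inv : Invariant S T cur) where
      open Invariant inv

      grow : ∀ g γ → Crossing T g γ → Invariant (insert S g) (insert T (home (g , not γ))) cur
      grow g γ (al , Ta , Tb) = record
        { grown = attach grown g S-g γ a≢b (λ g' γ' Sg' eq → Boolₚ.not-¬ Tb (trans (cong T (sym eq)) (visited-S g' γ' Sg')))
        ; allowed-S = λ g' Sg' → [ (λ { refl → al }) , allowed-S g' ] (insert-inv S g g' Sg')
        ; visited-S = visited-S′ ; spanned = spanned′ ; frontier = frontier′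
        ; cur-visited = insert-mono T b cur cur-visited }
        where
        a b : Vx
        a = home (g , γ)
        b = home (g , not γ)
        S-g : S g ≡ false
        S-g with S g in eq
        ... | true = ⊥-elim (Boolₚ.not-¬ Tb (visited-S g (not γ) eq))
        ... | false = refl
        a≢b : a ≢ b
        a≢b eq = Boolₚ.not-¬ Tb (trans (cong T (sym eq)) Ta)
        lift : ∀ {u w} → Conn (TreeAdj S) u w → Conn (TreeAdj (insert S g)) u w
        lift = TreeAdj-mono (insert-mono S g)
        b~cur : Conn (TreeAdj (insert S g)) b cur
        b~cur = Conn-sym (edge-connects (insert S g) g (insert-self S g) γ) ◅◅ lift (frontier g γ al Ta Tb)
        visited-S′ : ∀ g' γ' → insert S g g' ≡ true → insert T b (home (g' , γ')) ≡ true
        visited-S′ g' γ' in-S' with insert-inv S g g' in-S'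
        ... | inj₂ Sg' = insert-mono T b _ (visited-S g' γ' Sg')
        ... | inj₁ refl with γ' Boolₚ.≟ γ
        ...   | yes refl = insert-mono T b _ Ta
        ...   | no γ'≢γ = subst (λ z → insert T b (home (g , z)) ≡ true) (sym (Boolₚ.¬-not γ'≢γ)) (insert-self T b)
        spanned′ : ∀ g' → allowed g' ≡ true → insert T b (home (g' , false)) ≡ true → insert T b (home (g' , true)) ≡ true →
                   Conn (TreeAdj (insert S g)) (home (g' , false)) (home (g' , true))
        spanned′ g' al' tu tw with insert-inv T b _ tu | insert-inv T b _ tw
        ... | inj₂ u | inj₂ w = lift (spanned g' al' u w)
        ... | inj₁ u | inj₁ w = ≡⇒Conn (trans u (sym w))
        ... | inj₁ u | inj₂ w = ≡⇒Conn u ◅◅ b~cur ◅◅ Conn-sym (lift (frontier g' true al' w (subst (λ z → T z ≡ false) (sym u) Tb)))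
        ... | inj₂ u | inj₁ w = lift (frontier g' false al' u (subst (λ z → T z ≡ false) (sym w) Tb)) ◅◅ Conn-sym b~cur ◅◅ ≡⇒Conn (sym w)
        frontier′ : ∀ g' γ' → allowed g' ≡ true → insert T b (home (g' , γ')) ≡ true → insert T b (home (g' , not γ')) ≡ false →
                    Conn (TreeAdj (insert S g)) (home (g' , γ')) cur
        frontier′ g' γ' al' ty tz with insert-inv T b _ ty
        ... | inj₁ y = ≡⇒Conn y ◅◅ b~cur
        ... | inj₂ y = lift (frontier g' γ' al' y (insert-false T _ _ tz))

      restart : ¬ (Σ E λ g → Σ Bool λ γ → Crossing T g γ) → ∀ r → T r ≡ false → Invariant S (insert T r) r
      restart no-crossing r Tr = record
        { grown = grown ; allowed-S = allowed-S ; visited-S = λ g γ Sg → insert-mono T r _ (visited-S g γ Sg)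
        ; spanned = spanned′ ; frontier = frontier′ ; cur-visited = insert-self T r }
        where
        spanned′ : ∀ g → allowed g ≡ true → insert T r (home (g , false)) ≡ true → insert T r (home (g , true)) ≡ true →
                   Conn (TreeAdj S) (home (g , false)) (home (g , true))
        spanned′ g al tu tw with insert-inv T r _ tu | insert-inv T r _ tw
        ... | inj₂ u | inj₂ w = spanned g al u w
        ... | inj₁ u | inj₁ w = ≡⇒Conn (trans u (sym w))
        ... | inj₁ u | inj₂ w = ⊥-elim (no-crossing (g , true , al , w , subst (λ z → T z ≡ false) (sym u) Tr))
        ... | inj₂ u | inj₁ w = ⊥-elim (no-crossing (g , false , al , u , subst (λ z → T z ≡ false) (sym w) Tr))
        frontier′ : ∀ g γ → allowed g ≡ true → insert T r (home (g , γ)) ≡ true → insert T r (home (g , not γ)) ≡ false →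
                    Conn (TreeAdj S) (home (g , γ)) r
        frontier′ g γ al ty tz with insert-inv T r _ ty
        ... | inj₁ y = ≡⇒Conn y
        ... | inj₂ y = ⊥-elim (no-crossing (g , γ , al , y , insert-false T _ _ tz))

      finish : (∀ w → T w ≡ true) → Forest
      finish all = record { S = S ; grown = grown ; allowed-S = allowed-S ; span = λ g al → spanned g al (all _) (all _) }

    run : ∀ fuel {S T cur} → unvisited T ≤ fuel → Invariant S T cur → Forest
    run fuel {T = T} bound inv with crossing? T | Finₚ.any? (λ w → T w Boolₚ.≟ false)
    ... | no no-crossing | no all-visited = finish inv (λ w → Boolₚ.¬-not (λ Tw → all-visited (w , Tw)))
    run zero {T = T} bound inv | yes (_ , _ , _ , _ , Tb) | _ = ⊥-elim (Boolₚ.not-¬ Tb (unvisited≡0 T (ℕₚ.n≤0⇒n≡0 bound) _))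
    run zero {T = T} bound inv | no _ | yes (r , Tr) = ⊥-elim (Boolₚ.not-¬ Tr (unvisited≡0 T (ℕₚ.n≤0⇒n≡0 bound) r))
    run (suc fuel) {T = T} bound inv | yes (g , γ , c) | _ =
      run fuel (ℕₚ.≤-pred (ℕₚ.<-≤-trans (unvisited-insert T _ (proj₂ (proj₂ c))) bound)) (grow inv g γ c)
    run (suc fuel) {T = T} bound inv | no no-crossing | yes (r , Tr) =
      run fuel (ℕₚ.≤-pred (ℕₚ.<-≤-trans (unvisited-insert T r Tr) bound)) (restart inv no-crossing r Tr)

    prim : ∀ {T cur} → Invariant S₀ T cur → Forest
    prim {T} = run (unvisited T) ℕₚ.≤-refl

flip-involutive : ∀ t s → (if t then (if t then s else not s) else not (if t then s else not s)) ≡ s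
flip-involutive true s = refl
flip-involutive false s = Boolₚ.not-involutive s

-- The subgraph Q = G^{τ(Z)} \ (E \ T) of a set T of edges (T = edges labelled dot or hat).
module Spanning (G : RibbonGraph) (T Z : Edge G → Bool) where
  open RibbonGraphFacts G
  open SpanningForest G

  partition : Partition G
  partition f = if T f then (if Z f then hat else dot) else bar

  Q : PreRibbon
  Q = ofPartition partition
  open Boundary Q

  T⇒¬bar : ∀ f → T f ≡ true → isBar (partition f) ≡ false
  T⇒¬bar f Tf rewrite Tf with Z f
  ... | true = refl
  ... | false = refl

  ¬bar⇒T : ∀ f → isBar (partition f) ≡ false → T f ≡ true
  ¬bar⇒T f ¬bar with T f
  ... | true = refl
  ... | false = ⊥-elim (Boolₚ.not-¬ ¬bar refl)

  edgeAt-T : ∀ v i → T (edgeAt v i) ≡ true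
  edgeAt-T v i = ¬bar⇒T _ (Boolₚ.not-injective (lookup-filterB-kept (kept (isBar ∘ partition)) (rot P v) i))

  posQ : ∀ h → T (proj₁ h) ≡ true → Σ (Pos (home h)) λ q → lookup (rot Q (home h)) q ≡ h
  posQ h Th = let (q , lk , _) = Sub-homePos (isHat ∘ partition) (isBar ∘ partition) h (T⇒¬bar (proj₁ h) Th) in q , lk

  home-at : ∀ w (j : Pos w) → home (lookup (rot Q w) j) ≡ w
  home-at w j = sym (home-unique (lookup-keptPos (kept (isBar ∘ partition)) (rot P w) j))

  corner-cong : ∀ v w (i : Pos v) (j : Pos w) s → v ≡ w → toℕ i ≡ toℕ j → corner v i s ≡ corner w j s
  corner-cong v .v i j s refl i≡j = cong (λ z → corner v z s) (Finₚ.toℕ-injective i≡j)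

  Q-occUniq : ∀ v w (i : Pos v) (j : Pos w) → lookup (rot Q v) i ≡ lookup (rot Q w) j → v ≡ w × toℕ i ≡ toℕ j
  Q-occUniq = Sub-occUniq (isHat ∘ partition) (isBar ∘ partition)

  Q-pos-injective : ∀ v (i j : Pos v) → lookup (rot Q v) i ≡ lookup (rot Q v) j → i ≡ j
  Q-pos-injective = Sub-pos-injective (isHat ∘ partition) (isBar ∘ partition)

  posQ-at : ∀ {w} h → home h ≡ w → T (proj₁ h) ≡ true → Σ (Pos w) λ q → lookup (rot Q w) q ≡ h
  posQ-at h refl Th = posQ h Th

  corner-by-halfEdge : ∀ {v w} {i : Pos v} {j : Pos w} s → lookup (rot Q v) i ≡ lookup (rot Q w) j → corner v i s ≡ corner w j s
  corner-by-halfEdge {v} {w} {i} {j} s eq = let (v≡w , i≡j) = Q-occUniq v w i j eq in corner-cong v w i j s v≡w i≡j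

  edge-link : ∀ S f → S f ≡ true → ∀ β (ia : Pos (home (f , β))) (ib : Pos (home (f , not β))) →
              lookup (rot Q (home (f , β))) ia ≡ (f , β) → lookup (rot Q (home (f , not β))) ib ≡ (f , not β) →
              ∀ s → Σ Bool λ s' → Conn (Bypassed S) (corner _ ia s) (corner _ ib s')
  edge-link S f Sf false ia ib la lb s = _ , Conn-return (edgeArc _ ia _ ib f s Sf la lb)
  edge-link S f Sf true ia ib la lb s =
    let s' = if tw Q f then s else not s in
    s' , Conn-return˘ (subst (λ z → Bypassed S (corner _ ib s') (corner _ ia z)) (flip-involutive (tw Q f) s) (edgeArc _ ib _ ia f s' Sf lb la))

  Grown⇒LocallyConnected : ∀ {S₀ S} → Grown S₀ S → (∀ g → S g ≡ true → T g ≡ true) → LocallyConnected S₀ → LocallyConnected S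
  Grown⇒LocallyConnected start _ lc₀ = lc₀
  Grown⇒LocallyConnected (attach {S} gr f Sf β a≢b fresh) S⊆T lc₀ =
    LocallyConnected-attach S f Sf pa ia pb ib ends fresh-pb only-f link (Grown⇒LocallyConnected gr (λ g Sg → S⊆T g (insert-mono S f g Sg)) lc₀)
    where
    Tf : T f ≡ true
    Tf = S⊆T f (insert-self S f)
    pa pb : Vx
    pa = home (f , β)
    pb = home (f , not β)
    ia : Pos pa
    ia = proj₁ (posQ (f , β) Tf)
    ib : Pos pb
    ib = proj₁ (posQ (f , not β) Tf)
    lka : lookup (rot Q pa) ia ≡ (f , β)
    lka = proj₂ (posQ (f , β) Tf)
    lkb : lookup (rot Q pb) ib ≡ (f , not β)
    lkb = proj₂ (posQ (f , not β) Tf)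
    ends : ∀ v i → edgeAt v i ≡ f → corner v i false ≡ corner pa ia false ⊎ corner v i false ≡ corner pb ib false
    ends v i eq with proj₂ (lookup (rot Q v) i) Boolₚ.≟ β
    ... | yes b = let (x , y) = Q-occUniq v pa i ia (trans (cong₂ _,_ eq b) (sym lka)) in inj₁ (corner-cong v pa i ia false x y)
    ... | no nb = let (x , y) = Q-occUniq v pb i ib (trans (cong₂ _,_ eq (Boolₚ.¬-not nb)) (sym lkb)) in inj₂ (corner-cong v pb i ib false x y)
    fresh-pb : ∀ j → S (edgeAt pb j) ≡ false
    fresh-pb j = Boolₚ.¬-not (λ S-j → fresh (edgeAt pb j) (proj₂ (lookup (rot Q pb) j)) S-j (home-at pb j))
    only-f : ∀ j → edgeAt pb j ≡ f → j ≡ ib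
    only-f j eq with proj₂ (lookup (rot Q pb) j) Boolₚ.≟ β
    ... | yes b = ⊥-elim (a≢b (trans (sym (cong home (cong₂ _,_ eq b))) (home-at pb j)))
    ... | no nb = Q-pos-injective pb j ib (trans (cong₂ _,_ eq (Boolₚ.¬-not nb)) (sym lkb))
    link : ∀ s → Σ Bool λ s' → Conn (Bypassed (insert S f)) (corner pa ia s) (corner pb ib s')
    link = edge-link (insert S f) f (insert-self S f) β ia ib lka lkb

  -- If the edges T span G and are grown from S₀ (around whose vertices the boundary of S₀ is
  -- connected), then every boundary component of Q meets every vertex of its component of G,
  -- so b(Q) = k(G).
  spanning⇒InQ : ∀ {S₀} n → LocallyConnected S₀ → Grown S₀ T → (∀ {u w} → Adj P u w → Conn (TreeAdj T) u w) →
                 ComponentCount P n → InQ G partition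
  spanning⇒InQ {S₀} n lc₀ grown span (r , distinct , cover) = n , (pointAt ∘ r , distinct′ , cover′) , (r , distinct , cover)
    where
    local : ∀ x y → vertexOf x ≡ vertexOf y → Conn (BRel Q) x y
    local x y eq = Conn-mono (Conn-return ∘ Bypassed⇒BRel T edgeAt-T) (Grown⇒LocallyConnected grown (λ _ → id) lc₀ x y eq)
    TreeAdj⇒AdjQ : ∀ {u w} → TreeAdj T u w → Conn (Adj Q) u w
    TreeAdj⇒AdjQ (g , Tg , refl , refl) = Conn-return (g , posQ (g , false) Tg , posQ (g , true) Tg)
    along : ∀ {u w} → Conn (Adj Q) u w → ∀ x y → vertexOf x ≡ u → vertexOf y ≡ w → Conn (BRel Q) x y
    along ε x y ex ey = local x y (trans ex (sym ey))
    along (inj₁ (g , (i , l₁) , (j , l₂)) ◅ rest) x y ex ey =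
      local x (corner _ i false) ex ◅◅ Conn-return (arc (edgeArc _ i _ j g false l₁ l₂)) ◅◅ along rest _ y refl ey
    along (inj₂ (g , (i , l₁) , (j , l₂)) ◅ rest) x y ex ey =
      local x (corner _ j (if tw Q g then false else true)) ex ◅◅ Conn-return˘ (arc (edgeArc _ i _ j g false l₁ l₂)) ◅◅ along rest _ y refl ey
    distinct′ : ∀ i j → Conn (BRel Q) (pointAt (r i)) (pointAt (r j)) → i ≡ j
    distinct′ i j c = distinct i j (Conn-mono (Conn-return ∘ Adj-Sub⇒Adj (isHat ∘ partition) (isBar ∘ partition))
                        (subst₂ (Conn (Adj Q)) (vertexOf-pointAt (r i)) (vertexOf-pointAt (r j)) (Conn-map vertexOf BRel⇒Adj c)))
    cover′ : ∀ x → ∃ λ i → Conn (BRel Q) x (pointAt (r i))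
    cover′ x = let (i , c) = cover (vertexOf x) in
               i , along (Conn-mono (Conn-mono TreeAdj⇒AdjQ ∘ span) c) x (pointAt (r i)) refl (vertexOf-pointAt (r i))

Basis : (G : RibbonGraph) → Edge G → Lbl → Set
Basis G e l = Σ (Partition G) λ p → InQ G p × p e ≡ l

dotOrHat : Bool → Lbl
dotOrHat z = if z then hat else dot

isHat-dotOrHat : ∀ z → isHat (dotOrHat z) ≡ z
isHat-dotOrHat true = refl
isHat-dotOrHat false = refl

module EdgeBases (G : RibbonGraph) (e : Edge G) where
  open RibbonGraphFacts G
  open SpanningForest G
  open Components G

  a b : Vx
  a = home (e , false)
  b = home (e , true)

  G∖e : PreRibbon
  G∖e = deleteEdges P (λ f → does (f Fin.≟ e))

  only-e : E → Bool
  only-e g = does (g Fin.≟ e)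

  span-from : ∀ {S} → (∀ g → only-e g ≡ false → Conn (TreeAdj S) (home (g , false)) (home (g , true))) →
              Conn (TreeAdj S) a b → ∀ {u w} → Adj P u w → Conn (TreeAdj S) u w
  span-from {S} span-others a~b adj = let (g , g-from , g-to) = Adj⇒edge adj in
                                      subst₂ (Conn (TreeAdj S)) g-from g-to (span-edge g (g Fin.≟ e))
    where
    span-edge : ∀ g → Dec (g ≡ e) → Conn (TreeAdj S) (home (g , false)) (home (g , true))
    span-edge g (yes refl) = a~b
    span-edge g (no g≢e) = span-others g (dec-false (g Fin.≟ e) g≢e)

  -- A spanning forest of G \ e, which still spans G when the ends of e are connected in G \ e.
  bar-basis : Conn (Adj G∖e) a b → Basis G e bar
  bar-basis a~b = partition , spanning⇒InQ (Labelling.k components) lc₀ (Forest.grown F) span (Labelling.classes components) , e-bar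
    where
    open Prim (not ∘ only-e) (λ _ → false)
    only-a : ∀ {w} → insert (λ _ → false) a w ≡ true → w ≡ a
    only-a {w} Tw = [ id , (λ ()) ]′ (insert-inv (λ _ → false) a w Tw)
    inv : Invariant (λ _ → false) (insert (λ _ → false) a) a
    inv = record
      { grown = start ; allowed-S = λ _ () ; visited-S = λ _ _ ()
      ; spanned = λ _ _ tu tw → ≡⇒Conn (trans (only-a tu) (sym (only-a tw)))
      ; frontier = λ _ _ _ ty _ → ≡⇒Conn (only-a ty) ; cur-visited = insert-self _ a }
    F : Forest
    F = prim inv
    open Forest F using (S)
    open Spanning G S (λ _ → false)
    open Boundary Q
    S-e : S e ≡ false
    S-e = Boolₚ.¬-not (λ S-e → Boolₚ.not-¬ (Forest.allowed-S F e S-e) (cong not (dec-true (e Fin.≟ e) refl)))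
    e-bar : partition e ≡ bar
    e-bar = cong (if_then dot else bar) S-e
    lc₀ : LocallyConnected (λ _ → false)
    lc₀ = LocallyConnected-atMostOne (λ _ → false) (λ _ _ _ ())
    span : ∀ {u w} → Adj P u w → Conn (TreeAdj S) u w
    span = span-from (λ g not-e → Forest.span F g (cong not not-e))
             (Conn-mono (λ adj → let (g , kept-g , g-from , g-to) = Adj-deleteEdges⇒KeptAdj _ adj in
                                 subst₂ (Conn (TreeAdj S)) g-from g-to (Forest.span F g kept-g)) a~b)

  -- The half-edges of a non-loop lie at different vertices, so e alone meets each vertex once.
  nonLoop-locallyConnected : a ≢ b → ∀ T Z → Boundary.LocallyConnected (Spanning.Q G T Z) only-e
  nonLoop-locallyConnected a≢b T Z = LocallyConnected-atMostOne only-e at-most-one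
    where
    open Spanning G T Z
    open Boundary Q
    at-most-one : ∀ w → AtMostOne only-e w
    at-most-one w j j' e-j e-j' = by-side (proj₂ (lookup (rot Q w) j) Boolₚ.≟ proj₂ (lookup (rot Q w) j'))
      where
      e-home : ∀ j → only-e (edgeAt w j) ≡ true → home (e , proj₂ (lookup (rot Q w) j)) ≡ w
      e-home j e-j = trans (cong (λ g → home (g , proj₂ (lookup (rot Q w) j))) (sym (does⇒ (_ Fin.≟ e) e-j))) (home-at w j)
      both-at-w : ∀ β β' → β ≢ β' → home (e , β) ≡ w → home (e , β') ≡ w → a ≡ b
      both-at-w false false β≢β' _ _ = ⊥-elim (β≢β' refl)
      both-at-w false true _ x y = trans x (sym y)
      both-at-w true false _ x y = trans y (sym x)
      both-at-w true true β≢β' _ _ = ⊥-elim (β≢β' refl)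
      by-side : Dec (proj₂ (lookup (rot Q w) j) ≡ proj₂ (lookup (rot Q w) j')) → j ≡ j'
      by-side (yes same) = Q-pos-injective w j j' (cong₂ _,_ (trans (does⇒ (_ Fin.≟ e) e-j) (sym (does⇒ (_ Fin.≟ e) e-j'))) same)
      by-side (no different) = ⊥-elim (a≢b (both-at-w _ _ different (e-home j e-j) (e-home j' e-j')))

  nonLoop-invariant : Prim.Invariant (λ _ → true) only-e only-e (insert (insert (λ _ → false) a) b) a
  nonLoop-invariant = record
    { grown = start ; allowed-S = λ _ _ → refl
    ; visited-S = λ { g false e-g → subst (λ f → T₀ (home (f , false)) ≡ true) (sym (does⇒ (g Fin.≟ e) e-g)) T₀a
                    ; g true e-g → subst (λ f → T₀ (home (f , true)) ≡ true) (sym (does⇒ (g Fin.≟ e) e-g)) (insert-self (insert (λ _ → false) a) b) }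
    ; spanned = λ _ _ tu tw → to-a tu ◅◅ Conn-sym (to-a tw)
    ; frontier = λ _ _ _ ty _ → to-a ty ; cur-visited = T₀a }
    where
    T₀ : Vx → Bool
    T₀ = insert (insert (λ _ → false) a) b
    T₀a : T₀ a ≡ true
    T₀a = insert-mono (insert (λ _ → false) a) b a (insert-self _ a)
    to-a : ∀ {w} → T₀ w ≡ true → Conn (TreeAdj only-e) w a
    to-a {w} T₀w = [ (λ { refl → Conn-sym (edge-connects only-e e (dec-true (e Fin.≟ e) refl) false) })
                   , (λ Tw → [ ≡⇒Conn , (λ ()) ]′ (insert-inv (λ _ → false) a w Tw)) ]′
                   (insert-inv (insert (λ _ → false) a) b w T₀w)

  -- A spanning tree containing the non-loop e.
  nonLoop-basis : a ≢ b → ∀ z → Basis G e (dotOrHat z)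
  nonLoop-basis a≢b z =
    partition , spanning⇒InQ (Labelling.k components) (nonLoop-locallyConnected a≢b S Z) (Forest.grown F) span (Labelling.classes components) , e-label
    where
    open Prim (λ _ → true) only-e
    F : Forest
    F = prim nonLoop-invariant
    open Forest F using (S)
    Z : E → Bool
    Z g = only-e g ∧ z
    open Spanning G S Z
    e-label : partition e ≡ dotOrHat z
    e-label = trans (cong (λ t → if t then dotOrHat (Z e) else bar) (Grown-⊇ (Forest.grown F) e (dec-true (e Fin.≟ e) refl)))
                    (cong (λ d → dotOrHat (d ∧ z)) (dec-true (e Fin.≟ e) refl))
    span : ∀ {u w} → Adj P u w → Conn (TreeAdj S) u w
    span adj = let (g , g-from , g-to) = Adj⇒edge adj in subst₂ (Conn (TreeAdj S)) g-from g-to (Forest.span F g refl)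

-- For a loop e interlaced with a cycle: the cycle, closed up by a simple path of the split graph,
-- together with e and untwisted, is a quasi-tree; extended to a spanning tree it gives a basis
-- in which e is labelled dot or hat at will.
module InterlacedLoopBasis (G : RibbonGraph) (e : Edge G) (L : Loop.LoopAt G e) where
  open RibbonGraphFacts G
  open Loop G e using (module Split)
  open SplitCycles G e L
  open SpanningForest G

  e-home′ : ∀ γ → home (e , γ) ≡ v
  e-home′ γ = e-home (lookup-homePos (e , γ))

  module OverPath (π : Path zero (suc v)) (σ : Simple π) (z : Bool) where
    k : ℕ
    k = steps π

    orient : Fin k → Bool
    orient j = proj₁ (oriented-ends (edge-joins π j))

    srcHE dstHE : Fin k → HE
    srcHE j = edge π j , orient j
    dstHE j = edge π j , not (orient j)

    site-src : ∀ j → site (srcHE j) ≡ vertex π (inject₁ j)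
    site-src j = proj₁ (proj₂ (oriented-ends (edge-joins π j)))

    site-dst : ∀ j → site (dstHE j) ≡ vertex π (suc j)
    site-dst j = proj₂ (proj₂ (oriented-ends (edge-joins π j)))

    home-src : ∀ j → home (srcHE j) ≡ unsplit (vertex π (inject₁ j))
    home-src j = trans (home≡unsplit-site _) (cong unsplit (site-src j))

    home-dst : ∀ j → home (dstHE j) ≡ unsplit (vertex π (suc j))
    home-dst j = trans (home≡unsplit-site _) (cong unsplit (site-dst j))

    onPath? : ∀ g → Dec (Σ (Fin k) λ j → edge π j ≡ g)
    onPath? g = Finₚ.any? (λ j → edge π j Fin.≟ g)

    S₀ : E → Bool
    S₀ g = does (g Fin.≟ e) ∨ does (onPath? g)

    -- e carries the requested label, and the path edges are untwisted.
    Z : E → Bool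
    Z g = (does (g Fin.≟ e) ∧ z) ∨ (does (onPath? g) ∧ tw P g)

    S₀-e : S₀ e ≡ true
    S₀-e = cong (_∨ does (onPath? e)) (dec-true (e Fin.≟ e) refl)

    S₀-path : ∀ j → S₀ (edge π j) ≡ true
    S₀-path j = trans (cong (does (edge π j Fin.≟ e) ∨_) (dec-true (onPath? (edge π j)) (j , refl))) (Boolₚ.∨-zeroʳ _)

    S₀-inv : ∀ g → S₀ g ≡ true → g ≡ e ⊎ Σ (Fin k) λ j → edge π j ≡ g
    S₀-inv g = by-cases (g Fin.≟ e) (onPath? g)
      where
      by-cases : ∀ {X Y : Set} (x : Dec X) (y : Dec Y) → does x ∨ does y ≡ true → X ⊎ Y
      by-cases (yes x) _ _ = inj₁ x
      by-cases (no _) (yes y) _ = inj₂ y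

    T₀ : Vx → Bool
    T₀ w = does (Finₚ.any? (λ i → unsplit (vertex π i) Fin.≟ w))

    T₀-vertex : ∀ i → T₀ (unsplit (vertex π i)) ≡ true
    T₀-vertex i = dec-true (Finₚ.any? (λ i′ → unsplit (vertex π i′) Fin.≟ unsplit (vertex π i))) (i , refl)

    T₀-v : T₀ v ≡ true
    T₀-v = subst (λ w → T₀ w ≡ true) (cong unsplit (vertex-first π)) (T₀-vertex zero)

    path-to-v : ∀ i → Conn (TreeAdj S₀) (unsplit (vertex π i)) v
    path-to-v = Data.Fin.Induction.<-weakInduction (λ i → Conn (TreeAdj S₀) (unsplit (vertex π i)) v)
      (≡⇒Conn (cong unsplit (vertex-first π)))
      (λ j to-v → Conn-sym (subst₂ (Conn (TreeAdj S₀)) (home-src j) (home-dst j) (edge-connects S₀ (edge π j) (S₀-path j) (orient j))) ◅◅ to-v)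

    invariant₀ : Prim.Invariant (λ _ → true) S₀ S₀ T₀ v
    invariant₀ = record
      { grown = start ; allowed-S = λ _ _ → refl ; visited-S = visited
      ; spanned = λ _ _ tu tw → to-v tu ◅◅ Conn-sym (to-v tw)
      ; frontier = λ _ _ _ ty _ → to-v ty ; cur-visited = T₀-v }
      where
      to-v : ∀ {w} → T₀ w ≡ true → Conn (TreeAdj S₀) w v
      to-v {w} T₀w = let (i , eq) = does⇒ (Finₚ.any? (λ i → unsplit (vertex π i) Fin.≟ w)) T₀w in ≡⇒Conn (sym eq) ◅◅ path-to-v i
      visited-path : ∀ j γ → Dec (γ ≡ orient j) → T₀ (home (edge π j , γ)) ≡ true
      visited-path j γ (yes refl) = subst (λ w → T₀ w ≡ true) (sym (home-src j)) (T₀-vertex _)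
      visited-path j γ (no γ≢) = subst (λ w → T₀ w ≡ true) (sym (trans (cong (λ b → home (edge π j , b)) (Boolₚ.¬-not γ≢)) (home-dst j))) (T₀-vertex _)
      visited-S₀ : ∀ {g} γ → g ≡ e ⊎ (Σ (Fin k) λ j → edge π j ≡ g) → T₀ (home (g , γ)) ≡ true
      visited-S₀ γ (inj₁ refl) = subst (λ w → T₀ w ≡ true) (sym (e-home′ γ)) T₀-v
      visited-S₀ γ (inj₂ (j , refl)) = visited-path j γ (γ Boolₚ.≟ orient j)
      visited : ∀ g γ → S₀ g ≡ true → T₀ (home (g , γ)) ≡ true
      visited g γ S₀g = visited-S₀ γ (S₀-inv g S₀g)

    F : Prim.Forest (λ _ → true) S₀
    F = Prim.prim (λ _ → true) S₀ invariant₀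
    S = Prim.Forest.S F
    open Spanning G S Z public

    S-e : S e ≡ true
    S-e = Grown-⊇ (Prim.Forest.grown F) e S₀-e

    S-path : ∀ j → S (edge π j) ≡ true
    S-path j = Grown-⊇ (Prim.Forest.grown F) _ (S₀-path j)

    Z-e : Z e ≡ z
    Z-e = trans (cong₂ (λ x y → (x ∧ z) ∨ (y ∧ tw P e)) (dec-true (e Fin.≟ e) refl) (dec-false (onPath? e) (λ (j , eq) → edge-ok π j eq)))
                (Boolₚ.∨-identityʳ z)

    Z-path : ∀ j → Z (edge π j) ≡ tw P (edge π j)
    Z-path j = cong₂ (λ x y → (x ∧ z) ∨ (y ∧ tw P (edge π j))) (dec-false (edge π j Fin.≟ e) (edge-ok π j)) (dec-true (onPath? (edge π j)) (j , refl))

    e-label : partition e ≡ dotOrHat z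
    e-label = trans (cong (λ t → if t then dotOrHat (Z e) else bar) S-e) (cong dotOrHat Z-e)

    path-untwisted : ∀ j → tw Q (edge π j) ≡ false
    path-untwisted j = trans (cong (λ t → tw P g xor isHat (if t then dotOrHat (Z g) else bar)) (S-path j))
                             (trans (cong (λ b → tw P g xor isHat (dotOrHat b)) (Z-path j))
                                    (trans (cong (tw P g xor_) (isHat-dotOrHat (tw P g))) (Boolₚ.xor-same (tw P g))))
      where g = edge π j

module PathCorners (G : RibbonGraph) (e : Edge G) (L : Loop.LoopAt G e)
                   (π : SplitCycles.Path G e L zero (suc (Loop.LoopAt.v L))) (σ : SplitCycles.Simple G e L π) (z : Bool) where
  open RibbonGraphFacts G
  open SplitCycles G e L
  open InterlacedLoopBasis G e L
  open OverPath π σ z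
  open Boundary Q

  vertex≡zero⇒first : ∀ i → vertex π i ≡ zero → toℕ i ≡ 0
  vertex≡zero⇒first i eq = cong toℕ (vertex-injective π σ i zero (trans eq (sym (vertex-first π))))

  vertex≡top⇒last : ∀ i → vertex π i ≡ suc v → toℕ i ≡ k
  vertex≡top⇒last i eq = trans (cong toℕ (vertex-injective π σ i (fromℕ k) (trans eq (sym (vertex-last π))))) (Finₚ.toℕ-fromℕ k)

  unsplit≡v : ∀ a → unsplit a ≡ v → a ≡ zero ⊎ a ≡ suc v
  unsplit≡v zero _ = inj₁ refl
  unsplit≡v (suc w) eq = inj₂ (cong suc eq)

  unsplit-injective-off-v : ∀ a b → unsplit a ≡ unsplit b → unsplit b ≢ v → a ≡ b
  unsplit-injective-off-v zero b eq b≢v = ⊥-elim (b≢v (sym eq))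
  unsplit-injective-off-v (suc w) zero eq b≢v = ⊥-elim (b≢v refl)
  unsplit-injective-off-v (suc w) (suc w') eq _ = cong suc eq

  inject₁-not-top : ∀ (j : Fin k) → vertex π (inject₁ j) ≢ suc v
  inject₁-not-top j eq = ℕₚ.<-irrefl (trans (sym (Finₚ.toℕ-inject₁ j)) (vertex≡top⇒last _ eq)) (Finₚ.toℕ<n j)

  suc-not-zero : ∀ (j : Fin k) → vertex π (suc j) ≢ zero
  suc-not-zero j eq = ℕₚ.0≢1+n (sym (vertex≡zero⇒first (suc j) eq))

  srcPos : ∀ j → Pos (home (srcHE j))
  srcPos j = proj₁ (posQ (srcHE j) (S-path j))
  dstPos : ∀ j → Pos (home (dstHE j))
  dstPos j = proj₁ (posQ (dstHE j) (S-path j))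

  srcCorner dstCorner : Fin k → Bool → BPoint Q
  srcCorner j s = corner _ (srcPos j) s
  dstCorner j s = corner _ (dstPos j) s

  along-edge : ∀ j s → Conn (Bypassed S₀) (srcCorner j s) (dstCorner j (not s))
  along-edge j s = by-orient (orient j) (proj₂ (posQ (srcHE j) (S-path j))) (proj₂ (posQ (dstHE j) (S-path j)))
    where
    g : E
    g = edge π j
    arc′ : ∀ {v v'} {i : Pos v} {i' : Pos v'} s → lookup (rot Q v) i ≡ (g , false) → lookup (rot Q v') i' ≡ (g , true) →
           Bypassed S₀ (corner v i s) (corner v' i' (not s))
    arc′ s l₁ l₂ = subst (λ t → Bypassed S₀ _ (corner _ _ (if t then s else not s))) (path-untwisted j) (edgeArc _ _ _ _ g s (S₀-path j) l₁ l₂)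
    by-orient : ∀ β {ia : Pos (home (g , β))} {ib : Pos (home (g , not β))} →
                lookup (rot Q (home (g , β))) ia ≡ (g , β) → lookup (rot Q (home (g , not β))) ib ≡ (g , not β) →
                Conn (Bypassed S₀) (corner _ ia s) (corner _ ib (not s))
    by-orient false l₁ l₂ = Conn-return (arc′ s l₁ l₂)
    by-orient true {ia} {ib} l₁ l₂ =
      Conn-return˘ (subst (λ t → Bypassed S₀ (corner _ ib (not s)) (corner _ ia t)) (Boolₚ.not-involutive s) (arc′ (not s) l₂ l₁))

  -- Where two consecutive path edges j, j' meet at a vertex w ≠ v, they are the only edges of S₀ at w.
  module Junction (j j' : Fin k) (j'≡1+j : toℕ j' ≡ suc (toℕ j)) where
    w : Vx
    w = home (dstHE j)

    inject₁-j' : inject₁ j' ≡ suc j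
    inject₁-j' = Finₚ.toℕ-injective (trans (Finₚ.toℕ-inject₁ j') j'≡1+j)

    src-home : home (srcHE j') ≡ w
    src-home = trans (home-src j') (trans (cong (unsplit ∘ vertex π) inject₁-j') (sym (home-dst j)))

    inPos outPos : Pos w
    inPos = dstPos j
    outPos = proj₁ (posQ-at (srcHE j') src-home (S-path j'))

    lookup-in : lookup (rot Q w) inPos ≡ dstHE j
    lookup-in = proj₂ (posQ (dstHE j) (S-path j))
    lookup-out : lookup (rot Q w) outPos ≡ srcHE j'
    lookup-out = proj₂ (posQ-at (srcHE j') src-home (S-path j'))

    w≢v : w ≢ v
    w≢v eq = [ suc-not-zero j , (λ is-top → ℕₚ.<-irrefl (trans j'≡1+j (vertex≡top⇒last (suc j) is-top)) (Finₚ.toℕ<n j')) ]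
               (unsplit≡v (vertex π (suc j)) (trans (sym (home-dst j)) eq))

    in≢out : inPos ≢ outPos
    in≢out eq = ℕₚ.1+n≢n (sym (trans (cong toℕ (edge-injective π σ j j'
                  (cong proj₁ (trans (sym lookup-in) (trans (cong (lookup (rot Q w)) eq) lookup-out))))) j'≡1+j))

    only : ∀ y → S₀ (edgeAt w y) ≡ true → y ∈ inPos ∷ outPos ∷ []
    only y S₀y = by-edge (S₀-inv (edgeAt w y) S₀y)
      where
      γ : Bool
      γ = proj₂ (lookup (rot Q w) y)
      y-home : home (lookup (rot Q w) y) ≡ unsplit (vertex π (suc j))
      y-home = trans (home-at w y) (home-dst j)
      by-side : ∀ j'' → edge π j'' ≡ edgeAt w y → Dec (γ ≡ orient j'') → y ∈ inPos ∷ outPos ∷ []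
      by-side j'' on (yes same) = there (here (Q-pos-injective w y outPos (trans y-src (trans (cong srcHE j''≡j') (sym lookup-out)))))
        where
        y-src : lookup (rot Q w) y ≡ srcHE j''
        y-src = cong₂ _,_ (sym on) same
        j''≡j' : j'' ≡ j'
        j''≡j' = Finₚ.toℕ-injective (trans (sym (Finₚ.toℕ-inject₁ j''))
                   (trans (cong toℕ (vertex-injective π σ _ _ (unsplit-injective-off-v _ _
                            (trans (sym (home-src j'')) (trans (cong home (sym y-src)) y-home)) (w≢v ∘ trans (home-dst j)))))
                          (sym j'≡1+j)))
      by-side j'' on (no different) = here (Q-pos-injective w y inPos (trans y-dst (trans (cong dstHE j''≡j) (sym lookup-in))))
        where
        y-dst : lookup (rot Q w) y ≡ dstHE j''
        y-dst = cong₂ _,_ (sym on) (Boolₚ.¬-not different)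
        j''≡j : j'' ≡ j
        j''≡j = Finₚ.suc-injective (vertex-injective π σ _ _ (unsplit-injective-off-v _ _
                  (trans (sym (home-dst j'')) (trans (cong home (sym y-dst)) y-home)) (w≢v ∘ trans (home-dst j))))
      by-edge : edgeAt w y ≡ e ⊎ (Σ (Fin k) λ j'' → edge π j'' ≡ edgeAt w y) → y ∈ inPos ∷ outPos ∷ []
      by-edge (inj₁ is-e) = ⊥-elim (w≢v (trans (sym (home-at w y)) (trans (cong (λ g → home (g , γ)) is-e) (e-home′ γ))))
      by-edge (inj₂ (j'' , on)) = by-side j'' on (γ Boolₚ.≟ orient j'')

    open AtVertex S₀ w
    open TwoPresent inPos outPos in≢out (trans (cong (S₀ ∘ proj₁) lookup-in) (S₀-path j))
                    (trans (cong (S₀ ∘ proj₁) lookup-out) (S₀-path j')) only public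

    out-corner : ∀ s → corner w outPos s ≡ srcCorner j' s
    out-corner s = corner-by-halfEdge s (trans lookup-out (sym (proj₂ (posQ (srcHE j') (S-path j')))))

    through-true : Conn (Bypassed S₀) (dstCorner j true) (srcCorner j' false)
    through-true = p→q ◅◅ ≡⇒Conn (out-corner false)

    through-false : Conn (Bypassed S₀) (dstCorner j false) (srcCorner j' true)
    through-false = Conn-sym (≡⇒Conn (sym (out-corner true)) ◅◅ q→p)


  chain : ∀ (i₀ : Fin k) → toℕ i₀ ≡ 0 → ∀ n j → toℕ j ≡ n →
          Conn (Bypassed S₀) (srcCorner i₀ false) (dstCorner j true) × Conn (Bypassed S₀) (srcCorner i₀ true) (dstCorner j false)
  chain i₀ i₀≡0 zero j j≡0 =
    subst (λ i → Conn (Bypassed S₀) (srcCorner i₀ false) (dstCorner i true) × Conn (Bypassed S₀) (srcCorner i₀ true) (dstCorner i false))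
          (Finₚ.toℕ-injective (trans i₀≡0 (sym j≡0))) (along-edge i₀ false , along-edge i₀ true)
  chain i₀ i₀≡0 (suc n) j j≡ = extend (chain i₀ i₀≡0 n j⁻ j⁻≡n)
    where
    n<k : n < k
    n<k = ℕₚ.<-trans (ℕₚ.n<1+n n) (subst (_< k) j≡ (Finₚ.toℕ<n j))
    j⁻ : Fin k
    j⁻ = fromℕ< n<k
    j⁻≡n : toℕ j⁻ ≡ n
    j⁻≡n = Finₚ.toℕ-fromℕ< n<k
    open Junction j⁻ j (trans j≡ (cong suc (sym j⁻≡n)))
    extend : Conn (Bypassed S₀) (srcCorner i₀ false) (dstCorner j⁻ true) × Conn (Bypassed S₀) (srcCorner i₀ true) (dstCorner j⁻ false) →
             Conn (Bypassed S₀) (srcCorner i₀ false) (dstCorner j true) × Conn (Bypassed S₀) (srcCorner i₀ true) (dstCorner j false)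
    extend (x , y) = x ◅◅ through-true ◅◅ along-edge j false , y ◅◅ through-false ◅◅ along-edge j true

module LoopQuasiTree (G : RibbonGraph) (e : Edge G) (L : Loop.LoopAt G e)
                     (π : SplitCycles.Path G e L zero (suc (Loop.LoopAt.v L))) (σ : SplitCycles.Simple G e L π) (z : Bool) where
  open RibbonGraphFacts G
  open SplitCycles G e L
  open InterlacedLoopBasis G e L
  open SpanningForest G using (module Prim; TreeAdj)
  open OverPath π σ z
  open PathCorners G e L π σ z
  open Boundary Q
  open KeptLoop partition (T⇒¬bar e S-e) hiding (Q)

  private
    zero≢top : Fin.zero {nV P} ≢ suc v
    zero≢top ()

  i₀ iₙ : Fin k
  i₀ = proj₁ (first-step π zero≢top)
  iₙ = proj₁ (last-step π zero≢top)

  inject₁-i₀ : inject₁ i₀ ≡ zero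
  inject₁-i₀ = Finₚ.toℕ-injective (trans (Finₚ.toℕ-inject₁ i₀) (proj₂ (first-step π zero≢top)))

  suc-iₙ : suc iₙ ≡ fromℕ k
  suc-iₙ = Finₚ.toℕ-injective (trans (proj₂ (last-step π zero≢top)) (sym (Finₚ.toℕ-fromℕ k)))

  site-first : site (srcHE i₀) ≡ zero
  site-first = trans (site-src i₀) (trans (cong (vertex π) inject₁-i₀) (vertex-first π))

  site-last : site (dstHE iₙ) ≡ suc v
  site-last = trans (site-dst iₙ) (trans (cong (vertex π) suc-iₙ) (vertex-last π))

  m₁ m₂ : Pos v
  m₁ = proj₁ (posQ-at (srcHE i₀) (trans (home≡unsplit-site _) (cong unsplit site-first)) (S-path i₀))
  m₂ = proj₁ (posQ-at (dstHE iₙ) (trans (home≡unsplit-site _) (cong unsplit site-last)) (S-path iₙ))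

  lookup-m₁ : lookup (rot Q v) m₁ ≡ srcHE i₀
  lookup-m₁ = proj₂ (posQ-at (srcHE i₀) (trans (home≡unsplit-site _) (cong unsplit site-first)) (S-path i₀))
  lookup-m₂ : lookup (rot Q v) m₂ ≡ dstHE iₙ
  lookup-m₂ = proj₂ (posQ-at (dstHE iₙ) (trans (home≡unsplit-site _) (cong unsplit site-last)) (S-path iₙ))

  m₁-inside : toℕ loQ < toℕ m₁ × toℕ m₁ < toℕ hiQ
  m₁-inside = Function.Bundles.Equivalence.from (strictly-inside⇔Inside m₁)
                (subst Inside (sym lookup-m₁) (site≡zero⇒Inside _ site-first))

  m₂-outside : toℕ m₂ < toℕ loQ ⊎ toℕ hiQ < toℕ m₂
  m₂-outside = not-inside⇒outside m₂ (λ is-e → edge-ok π iₙ (trans (sym (cong proj₁ lookup-m₂)) is-e))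
                 (λ ins → proj₁ (site≡v⇒outside _ site-last) (subst Inside lookup-m₂ ins))

  only-at-v : ∀ y → S₀ (edgeAt v y) ≡ true → y ∈ loQ ∷ m₁ ∷ hiQ ∷ m₂ ∷ []
  only-at-v y S₀y = by-edge (S₀-inv (edgeAt v y) S₀y)
    where
    γ : Bool
    γ = proj₂ (lookup (rot Q v) y)
    e-side : edgeAt v y ≡ e → Dec (γ ≡ βlo) → y ∈ loQ ∷ m₁ ∷ hiQ ∷ m₂ ∷ []
    e-side is-e (yes same) = here (Q-pos-injective v y loQ (trans (cong₂ _,_ is-e same) (sym lookup-loQ)))
    e-side is-e (no different) = there (there (here (Q-pos-injective v y hiQ (trans (cong₂ _,_ is-e (Boolₚ.¬-not different)) (sym lookup-hiQ)))))
    src-at-v : ∀ j → lookup (rot Q v) y ≡ srcHE j → vertex π (inject₁ j) ≡ zero ⊎ vertex π (inject₁ j) ≡ suc v →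
               y ∈ loQ ∷ m₁ ∷ hiQ ∷ m₂ ∷ []
    src-at-v j y-src (inj₁ is-zero) = there (here (Q-pos-injective v y m₁ (trans y-src (trans (cong srcHE j≡i₀) (sym lookup-m₁)))))
      where
      j≡i₀ : j ≡ i₀
      j≡i₀ = Finₚ.inject₁-injective (vertex-injective π σ _ _ (trans is-zero (sym (trans (cong (vertex π) inject₁-i₀) (vertex-first π)))))
    src-at-v j _ (inj₂ is-top) = ⊥-elim (inject₁-not-top j is-top)
    dst-at-v : ∀ j → lookup (rot Q v) y ≡ dstHE j → vertex π (suc j) ≡ zero ⊎ vertex π (suc j) ≡ suc v →
               y ∈ loQ ∷ m₁ ∷ hiQ ∷ m₂ ∷ []
    dst-at-v j _ (inj₁ is-zero) = ⊥-elim (suc-not-zero j is-zero)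
    dst-at-v j y-dst (inj₂ is-top) = there (there (there (here (Q-pos-injective v y m₂ (trans y-dst (trans (cong dstHE j≡iₙ) (sym lookup-m₂)))))))
      where
      j≡iₙ : j ≡ iₙ
      j≡iₙ = Finₚ.suc-injective (vertex-injective π σ _ _ (trans is-top (sym (trans (cong (vertex π) suc-iₙ) (vertex-last π)))))
    path-side : ∀ j → edge π j ≡ edgeAt v y → Dec (γ ≡ orient j) → y ∈ loQ ∷ m₁ ∷ hiQ ∷ m₂ ∷ []
    path-side j on (yes same) = src-at-v j y-src (unsplit≡v _ (trans (sym (home-src j)) (trans (cong home (sym y-src)) (home-at v y))))
      where
      y-src : lookup (rot Q v) y ≡ srcHE j
      y-src = cong₂ _,_ (sym on) same
    path-side j on (no different) = dst-at-v j y-dst (unsplit≡v _ (trans (sym (home-dst j)) (trans (cong home (sym y-dst)) (home-at v y))))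
      where
      y-dst : lookup (rot Q v) y ≡ dstHE j
      y-dst = cong₂ _,_ (sym on) (Boolₚ.¬-not different)
    by-edge : edgeAt v y ≡ e ⊎ (Σ (Fin k) λ j → edge π j ≡ edgeAt v y) → y ∈ loQ ∷ m₁ ∷ hiQ ∷ m₂ ∷ []
    by-edge (inj₁ is-e) = e-side is-e (γ Boolₚ.≟ βlo)
    by-edge (inj₂ (j , on)) = path-side j on (γ Boolₚ.≟ orient j)

  private
    present-at-v : ∀ {q h} → lookup (rot Q v) q ≡ h → S₀ (proj₁ h) ≡ true → S₀ (edgeAt v q) ≡ true
    present-at-v lk S₀h = trans (cong (S₀ ∘ proj₁) lk) S₀h

  open AtVertex S₀ v
  open FourPresent loQ m₁ hiQ m₂ (proj₁ m₁-inside) (proj₂ m₁-inside) m₂-outside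
                   (present-at-v lookup-loQ S₀-e) (present-at-v lookup-m₁ (S₀-path i₀))
                   (present-at-v lookup-hiQ S₀-e) (present-at-v lookup-m₂ (S₀-path iₙ)) only-at-v

  m₁-corner : ∀ s → corner v m₁ s ≡ srcCorner i₀ s
  m₁-corner s = corner-by-halfEdge s (trans lookup-m₁ (sym (proj₂ (posQ (srcHE i₀) (S-path i₀)))))

  m₂-corner : ∀ s → corner v m₂ s ≡ dstCorner iₙ s
  m₂-corner s = corner-by-halfEdge s (trans lookup-m₂ (sym (proj₂ (posQ (dstHE iₙ) (S-path iₙ)))))

  along-path : Conn (Bypassed S₀) (srcCorner i₀ false) (dstCorner iₙ true) × Conn (Bypassed S₀) (srcCorner i₀ true) (dstCorner iₙ false)
  along-path = chain i₀ (proj₂ (first-step π zero≢top)) (toℕ iₙ) iₙ refl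

  X₀ : BPoint Q
  X₀ = corner v loQ true

  m₁-false : Conn (Bypassed S₀) (corner v m₁ false) X₀
  m₁-false = Conn-sym lo→m₁

  m₂-true : Conn (Bypassed S₀) (corner v m₂ true) X₀
  m₂-true = ≡⇒Conn (m₂-corner true) ◅◅ Conn-sym (proj₁ along-path) ◅◅ ≡⇒Conn (sym (m₁-corner false)) ◅◅ m₁-false

  lo-any : ∀ s → Conn (Bypassed S₀) (corner v loQ s) X₀
  lo-any true = ε
  lo-any false = Conn-sym m₂→lo ◅◅ m₂-true

  hi-any : ∀ s → Conn (Bypassed S₀) (corner v hiQ s) (corner v m₁ true)
  hi-any true = hi→m₂ ◅◅ ≡⇒Conn (m₂-corner false) ◅◅ Conn-sym (proj₂ along-path) ◅◅ ≡⇒Conn (sym (m₁-corner true))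
  hi-any false = Conn-sym m₁→hi

  -- The edge e joins the corners around loQ to those around hiQ.
  m₁-true : Conn (Bypassed S₀) (corner v m₁ true) X₀
  m₁-true = by-βlo βlo lookup-loQ lookup-hiQ
    where
    by-βlo : ∀ β → lookup (rot Q v) loQ ≡ (e , β) → lookup (rot Q v) hiQ ≡ (e , not β) → Conn (Bypassed S₀) (corner v m₁ true) X₀
    by-βlo false l h = Conn-sym (hi-any _) ◅◅ Conn-return˘ (edgeArc v loQ v hiQ e true S₀-e l h)
    by-βlo true l h = Conn-sym (hi-any true) ◅◅ Conn-return (edgeArc v hiQ v loQ e true S₀-e h l) ◅◅ lo-any _

  at-v : ∀ i s → Conn (Bypassed S₀) (corner v i s) X₀
  at-v i s = via (four-cover i s)
    where
    via : Σ (Pos v) (λ p → p ∈ loQ ∷ m₁ ∷ hiQ ∷ m₂ ∷ [] × Conn (Bypassed S₀) (corner v i s) (corner v p true)) →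
          Conn (Bypassed S₀) (corner v i s) X₀
    via (_ , here refl , c) = c
    via (_ , there (here refl) , c) = c ◅◅ m₁-true
    via (_ , there (there (here refl)) , c) = c ◅◅ hi-any true ◅◅ m₁-true
    via (_ , there (there (there (here refl))) , c) = c ◅◅ m₂-true

  at-junction : ∀ (j j' : Fin k) (j'≡1+j : toℕ j' ≡ suc (toℕ j)) i s → Conn (Bypassed S₀) (corner (home (dstHE j)) i s) X₀
  at-junction j j' j'≡1+j i s = [ via-in , via-out ]′ (two-cover i s)
    where
    open Junction j j' j'≡1+j
    from-path : Conn (Bypassed S₀) (srcCorner i₀ false) (dstCorner j true) × Conn (Bypassed S₀) (srcCorner i₀ true) (dstCorner j false)
    from-path = chain i₀ (proj₂ (first-step π zero≢top)) (toℕ j) j refl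
    via-in : Conn (Bypassed S₀) (corner w i s) (corner w inPos true) → Conn (Bypassed S₀) (corner w i s) X₀
    via-in c = c ◅◅ Conn-sym (proj₁ from-path) ◅◅ ≡⇒Conn (sym (m₁-corner false)) ◅◅ m₁-false
    via-out : Conn (Bypassed S₀) (corner w i s) (corner w outPos true) → Conn (Bypassed S₀) (corner w i s) X₀
    via-out c = c ◅◅ q→p ◅◅ Conn-sym (proj₂ from-path) ◅◅ ≡⇒Conn (sym (m₁-corner true)) ◅◅ m₁-true

  data Kind (w : Vx) : Set where
    at-loop     : w ≡ v → Kind w
    junction : ∀ (j j' : Fin k) → toℕ j' ≡ suc (toℕ j) → home (dstHE j) ≡ w → Kind w
    untouched   : (∀ y → S₀ (edgeAt w y) ≢ true) → Kind w

  kind : ∀ w → Kind w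
  kind w = search (Finₚ.any? (λ y → S₀ (edgeAt w y) Boolₚ.≟ true))
    where
    src-kind : ∀ j → home (srcHE j) ≡ w → ∀ n → toℕ j ≡ n → Kind w
    src-kind j hw zero j≡0 = at-loop (trans (sym hw) (trans (home-src j) (cong unsplit
                               (trans (cong (vertex π) (Finₚ.toℕ-injective {j = zero} (trans (Finₚ.toℕ-inject₁ j) j≡0))) (vertex-first π)))))
    src-kind j hw (suc n) j≡ = junction j⁻ j j≡1+j⁻ (trans (sym (Junction.src-home j⁻ j j≡1+j⁻)) hw)
      where
      n<k : n < k
      n<k = ℕₚ.<-trans (ℕₚ.n<1+n n) (subst (_< k) j≡ (Finₚ.toℕ<n j))
      j⁻ : Fin k
      j⁻ = fromℕ< n<k
      j≡1+j⁻ : toℕ j ≡ suc (toℕ j⁻)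
      j≡1+j⁻ = trans j≡ (cong suc (sym (Finₚ.toℕ-fromℕ< n<k)))
    dst-kind : ∀ j → home (dstHE j) ≡ w → suc (toℕ j) < k ⊎ suc (toℕ j) ≡ k → Kind w
    dst-kind j hw (inj₁ 1+j<k) = junction j (fromℕ< 1+j<k) (Finₚ.toℕ-fromℕ< 1+j<k) hw
    dst-kind j hw (inj₂ 1+j≡k) = at-loop (trans (sym hw) (trans (home-dst j) (cong unsplit
                                   (trans (cong (vertex π) (Finₚ.toℕ-injective (trans 1+j≡k (sym (Finₚ.toℕ-fromℕ k))))) (vertex-last π)))))
    by-side : ∀ y j → edge π j ≡ edgeAt w y → Dec (proj₂ (lookup (rot Q w) y) ≡ orient j) → Kind w
    by-side y j on (yes same) = src-kind j (trans (cong home (sym (cong₂ _,_ (sym on) same))) (home-at w y)) (toℕ j) refl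
    by-side y j on (no different) = dst-kind j (trans (cong home (sym (cong₂ _,_ (sym on) (Boolₚ.¬-not different)))) (home-at w y))
                                      (ℕₚ.m≤n⇒m<n∨m≡n (Finₚ.toℕ<n j))
    by-edge : ∀ y → edgeAt w y ≡ e ⊎ (Σ (Fin k) λ j → edge π j ≡ edgeAt w y) → Kind w
    by-edge y (inj₁ is-e) = at-loop (trans (sym (home-at w y)) (trans (cong (λ g → home (g , proj₂ (lookup (rot Q w) y))) is-e) (e-home′ _)))
    by-edge y (inj₂ (j , on)) = by-side y j on (proj₂ (lookup (rot Q w) y) Boolₚ.≟ orient j)
    search : Dec (Σ (Pos w) λ y → S₀ (edgeAt w y) ≡ true) → Kind w
    search (yes (y , S₀y)) = by-edge y (S₀-inv (edgeAt w y) S₀y)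
    search (no none) = untouched (λ y S₀y → none (y , S₀y))

  connected-corners : ∀ w i s i' s' → Conn (Bypassed S₀) (corner w i s) (corner w i' s')
  connected-corners w i s i' s' = by-kind (kind w)
    where
    by-kind : Kind w → Conn (Bypassed S₀) (corner w i s) (corner w i' s')
    by-kind (at-loop refl) = at-v i s ◅◅ Conn-sym (at-v i' s')
    by-kind (junction j j' j'≡1+j refl) = at-junction j j' j'≡1+j i s ◅◅ Conn-sym (at-junction j j' j'≡1+j i' s')
    by-kind (untouched none) = connected-at S₀ w (λ a _ S₀a _ → ⊥-elim (none a S₀a)) i s i' s'

  basis : Basis G e (dotOrHat z)
  basis = partition
        , spanning⇒InQ (Labelling.k components) (LocallyConnected-corners S₀ connected-corners) (Prim.Forest.grown F) span
                       (Labelling.classes components)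
        , e-label
    where
    open Components G
    span : ∀ {u w} → Adj P u w → Conn (TreeAdj S) u w
    span adj = let (g , g-from , g-to) = Adj⇒edge adj in subst₂ (Conn (TreeAdj S)) g-from g-to (Prim.Forest.span F g refl)

module Converse (G : RibbonGraph) (e : Edge G) where
  open RibbonGraphFacts G
  open Components G
  open EdgeBases G e

  ¬connected⇒bridge : ¬ Conn (Adj G∖e) a b → IsBridge G e
  ¬connected⇒bridge a≁b =
    k components , k (components-deleteEdges only-e) , classes components , classes (components-deleteEdges only-e) ,
    classes-< (classes (components-deleteEdges only-e)) (classes components) id (Conn-return ∘ Adj-Sub⇒Adj (λ _ → false) only-e)
              (λ w → w , ε) a b a≁b (Conn-return (e , (homePos (e , false) , lookup-homePos _) , (homePos (e , true) , lookup-homePos _)))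
    where open Labelling

  bridge-or-bar-basis : IsBridge G e ⊎ Basis G e bar
  bridge-or-bar-basis with Labelling.Conn? (components-deleteEdges only-e) a b
  ... | yes a~b = inj₂ (bar-basis a~b)
  ... | no a≁b = inj₁ (¬connected⇒bridge a≁b)

  module _ (a≡b : a ≡ b) where
    loop : IsLoop G e
    loop = a , (homePos (e , false) , lookup-homePos _) , subst (Incident G e true) (sym a≡b) (homePos (e , true) , lookup-homePos _)

    L : Loop.LoopAt G e
    L = Loop.loopAt G e loop
    open SplitCycles G e L

    split-connected? : Dec (Conn EdgeAdj zero (suc v))
    split-connected? = Labelling.Conn? (labelling-⇔ (labelling-edges _ (not ∘ only-e) (λ g → site (g , false)) (λ g → site (g , true)))
                         (λ (g , kept , x , y) → Conn-return (g , (λ g≡e → Boolₚ.not-¬ kept (cong not (dec-true (g Fin.≟ e) g≡e))) , x , y))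
                         (λ (g , g≢e , x , y) → Conn-return (g , cong not (dec-false (g Fin.≟ e) g≢e) , x , y)))
                       zero (suc v)

    loop-trivial-or-basis : ∀ z → IsTrivialLoop G e ⊎ Basis G e (dotOrHat z)
    loop-trivial-or-basis z with split-connected?
    ... | yes connected = let (π , σ) = loop-erase connected in inj₂ (LoopQuasiTree.basis G e L π σ z)
    ... | no separated = inj₁ (loop , λ C I → separated (interlaced⇒split-connected C I))

  trivial-or-dotOrHat-basis : ∀ z → IsTrivialLoop G e ⊎ Basis G e (dotOrHat z)
  trivial-or-dotOrHat-basis z with a Fin.≟ b
  ... | no a≢b = inj₂ (nonLoop-basis a≢b z)
  ... | yes a≡b = loop-trivial-or-basis a≡b z

singular⇒bridge⊎trivialLoop : ∀ G e → SingularClass G e → IsBridge G e ⊎ IsTrivialLoop G e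
singular⇒bridge⊎trivialLoop G e (bar , singular) = [ inj₁ , ⊥-elim ∘ singular ]′ (Converse.bridge-or-bar-basis G e)
singular⇒bridge⊎trivialLoop G e (dot , singular) = [ inj₂ , ⊥-elim ∘ singular ]′ (Converse.trivial-or-dotOrHat-basis G e false)
singular⇒bridge⊎trivialLoop G e (hat , singular) = [ inj₂ , ⊥-elim ∘ singular ]′ (Converse.trivial-or-dotOrHat-basis G e true)

trivialOrientable⇒dot-singular : ∀ G e → IsTrivialLoop G e → IsOrientableLoop G e → Singular G e dot
trivialOrientable⇒dot-singular G e trivial (_ , untwisted) = trivialLoop⇒singular G e dot trivial refl (cong (_xor false) untwisted)

trivialNonorientable⇒hat-singular : ∀ G e → IsTrivialLoop G e → IsNonorientableLoop G e → Singular G e hat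
trivialNonorientable⇒hat-singular G e trivial (_ , twisted) = trivialLoop⇒singular G e hat trivial refl (cong (_xor true) twisted)

bridge⊎trivialLoop⇒singular : ∀ G e → IsBridge G e ⊎ IsTrivialLoop G e → SingularClass G e
bridge⊎trivialLoop⇒singular G e (inj₁ bridge) = bar , RibbonGraphFacts.bridge⇒bar-singular G e bridge
bridge⊎trivialLoop⇒singular G e (inj₂ trivial) with tw (pre G) e in twist
... | false = dot , trivialOrientable⇒dot-singular G e trivial (proj₁ trivial , twist)
... | true = hat , trivialNonorientable⇒hat-singular G e trivial (proj₁ trivial , twist)

proposition6p4 : (G : RibbonGraph) (e : Edge G) →
    (SingularClass G e ⇔ (IsBridge G e ⊎ IsTrivialLoop G e))
    × (IsBridge G e → Singular G e bar)
    × (IsTrivialLoop G e → IsOrientableLoop G e → Singular G e dot)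
    × (IsTrivialLoop G e → IsNonorientableLoop G e → Singular G e hat)
proposition6p4 G e =
    mk⇔ (singular⇒bridge⊎trivialLoop G e) (bridge⊎trivialLoop⇒singular G e)
  , RibbonGraphFacts.bridge⇒bar-singular G e
  , trivialOrientable⇒dot-singular G e
  , trivialNonorientable⇒hat-singular G e
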